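{- For all signed permutations $\pi,\sigma$, $$F_{\mathrm{wcomp}(\pi)}F_{\mathrm{wcomp}(\sigma)}=\sum_{\tau}C^{\tau}_{\pi,\sigma}F_{\mathrm{wcomp}(\tau)},$$ where $\tau$ ranges over all signed permutations and $C^\tau_{\pi,\sigma}$ is the coefficient of $\tau$ in $\pi\overline{\star}_{ -1}\sigma$.
   Context: $\mathfrak{B}_n$ is the set of permutations $\pi$ of $\{ -n,\dots,n\}$ with $\pi(-i)=-\pi(i)$, written as words $\pi_1\cdots\pi_n$, $\mathfrak{B}_0=\{\imath\}$. $\mathrm{st}$ of a word $a_1\cdots a_n$ over $\mathbb{Z}\setminus\{0\}$ is the unique $b_1\cdots b_n\in\mathfrak{B}_n$ with $\mathrm{sign}(b_i)=\mathrm{sign}(a_i)$ and $|b_i|<|b_j|$ whenever $|a_i|<|a_j|$ or ($|a_i|=|a_j|$, $i<j$), extended linearly. On words over $\mathbb{Z}\setminus\{0\}$, $\star_{ -1}$ is the bilinear product with the empty word as identity and $au\star_{ -1}bv=a(u\star_{ -1}bv)+b(au\star_{ -1}v)-(a\bullet b)(u\star_{ -1}v)$, where $a\bullet b=a$ if $a,b<0$ and $0$ otherwise; $\pi\overline{\star}_{ -1}\sigma=\mathrm{st}(\pi\star_{ -1}\sigma[m])$ for $\pi\in\mathfrak{B}_m$, where $\sigma[m]$ replaces positive letters $i$ by $i+m$ and negative letters $-i$ by $-(i+m)$. $\widetilde{\mathbb{N}}=\mathbb{N}\cup\{\varepsilon\}$ with $0+\varepsilon=\varepsilon+\varepsilon=\varepsilon$,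 $n+\varepsilon=n$ for $n\ge1$; monomials in commuting $x_1,x_2,\dots$ have exponents in $\widetilde{\mathbb{N}}$, multiplied by adding exponents. A regularized composition is a finite sequence of elements of $\mathbb{P}\cup\{\varepsilon\}$; writing $\alpha=(\varepsilon^{i_1},s_1,\dots,\varepsilon^{i_k},s_k,\varepsilon^{i_{k+1}})$ with $s_q\in\mathbb{P}$, let $n=\sum i_p+\sum s_q$, $D(\alpha)=\{\sum_{j\le q}(i_j+s_j):q\in[k]\}$, $(e_1,\dots,e_n)=(\varepsilon^{i_1},1^{s_1},\dots,\varepsilon^{i_k},1^{s_k},\varepsilon^{i_{k+1}})$, and $F_\alpha=\sum x_{j_1}^{e_1}\cdots x_{j_n}^{e_n}$ over $j_1\le\cdots\le j_n$ with $j_p<j_{p+1}$ whenever $p\in D(\alpha)$, $p<n$ ($F_\emptyset=1$). For a word $w=w_1\cdots w_r$ of distinct positive integers, $\mathrm{comp}(w)$ is the composition of $r$ with set of partial sums $\{i\in[r-1]:w_i>w_{i+1}\}\cup\{r\}$. For $\pi\in\mathfrak{B}_n$ write $\pi=(N_1,B_1,\dots,N_k,B_k,N_{k+1})$ with $B_q$ the maximal nonempty runs of consecutive positive entries and $N_p$ consisting of $i_p\ge0$ negative entries; $\mathrm{wcomp}(\pi)=(\varepsilon^{i_1},\mathrm{comp}(B_1),\dots,\varepsilon^{i_k},\mathrm{comp}(B_k),\varepsilon^{i_{k+1}})$. -}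

module Defs where

open import Data.Bool using (Bool; true; false; if_then_else_; _∧_; _∨_)
open import Data.Nat as ℕ using (ℕ; zero; suc)
open import Data.Integer as ℤ using (ℤ; +_; -[1+_]; ∣_∣)
open import Data.List as L using (List; []; _∷_; _++_; map; concatMap; length; upTo; drop; replicate; foldr; zip; applyUpTo)
open import Data.List.Properties using (≡-dec)
open import Data.List.Relation.Unary.All using (All)
open import Data.List.Relation.Binary.Permutation.Propositional using (_↭_)
open import Data.Product using (_×_; _,_)
open import Data.Vec as V using (Vec; zipWith; tabulate)
open import Data.Fin using (Fin; toℕ)
open import Relation.Binary.PropositionalEquality using (_≡_; _≢_)
open import Relation.Nullary.Decidable using (does)

IsSignedPerm : ℕ → List ℤ → Set
IsSignedPerm n π = All (λ a → a ≢ + 0) π × (map ∣_∣ π ↭ applyUpTo suc n)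

isNeg : ℤ → Bool
isNeg -[1+ _ ] = true
isNeg (+ _)    = false

insertAll : ℕ → List ℕ → List (List ℕ)
insertAll x []       = (x ∷ []) ∷ []
insertAll x (y ∷ ys) = (x ∷ y ∷ ys) ∷ map (y ∷_) (insertAll x ys)

perms : List ℕ → List (List ℕ)
perms []       = [] ∷ []
perms (x ∷ xs) = concatMap (insertAll x) (perms xs)

signings : List ℕ → List (List ℤ)
signings []       = [] ∷ []
signings (k ∷ ks) = concatMap (λ s → (+ k ∷ s) ∷ (ℤ.- (+ k) ∷ s) ∷ []) (signings ks)

signedPerms : ℕ → List (List ℤ)
signedPerms n = concatMap signings (perms (applyUpTo suc n))

-- all signed permutations of size ≤ n (C^τ_{π,σ} vanishes unless |τ| ≤ m + n)
signedPermsUpTo : ℕ → List (List ℤ)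
signedPermsUpTo n = concatMap signedPerms (upTo (suc n))

LC : Set
LC = List (ℤ × List ℤ)

prep : ℤ → LC → LC
prep a = map (λ { (c , w) → (c , a ∷ w) })

star : List ℤ → List ℤ → LC
star [] v = (+ 1 , v) ∷ []
star (a ∷ u) [] = (+ 1 , a ∷ u) ∷ []
star u₀@(a ∷ u) v₀@(b ∷ v) =
  prep a (star u v₀) ++ prep b (star u₀ v) ++
  (if isNeg a ∧ isNeg b then map (λ { (c , w) → (ℤ.- c , a ∷ w) }) (star u v) else [])

st : List ℤ → List ℤ
st w = map f iw
  where
  iw : List (ℕ × ℤ)
  iw = zip (upTo (length w)) w
  before : ℕ × ℤ → ℕ × ℤ → Bool
  before (j , b) (i , a) = (∣ b ∣ ℕ.<ᵇ ∣ a ∣) ∨ ((∣ b ∣ ℕ.≡ᵇ ∣ a ∣) ∧ (j ℕ.<ᵇ i))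
  cnt : ℕ × ℤ → ℕ
  cnt p = foldr (λ q r → if before q p then suc r else r) 0 iw
  f : ℕ × ℤ → ℤ
  f (i , a) = if isNeg a then -[1+ cnt (i , a) ] else + suc (cnt (i , a))

shift : ℕ → ℤ → ℤ
shift m x = if isNeg x then x ℤ.- + m else x ℤ.+ + m

starBar : List ℤ → List ℤ → LC
starBar π σ = map (λ { (c , w) → (c , st w) }) (star π (map (shift (length π)) σ))

C : List ℤ → List ℤ → List ℤ → ℤ
C π σ τ = foldr (λ { (c , w) r → if does (≡-dec ℤ._≟_ w τ) then c ℤ.+ r else r }) (+ 0) (starBar π σ)

data Ñ : Set where
  fin : ℕ → Ñ
  ε   : Ñ

_⊕_ : Ñ → Ñ → Ñ
fin a ⊕ fin b = fin (a ℕ.+ b)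
fin zero ⊕ ε = ε
fin (suc k) ⊕ ε = fin (suc k)
ε ⊕ fin zero = ε
ε ⊕ fin (suc k) = fin (suc k)
ε ⊕ ε = ε

eqÑ : Ñ → Ñ → Bool
eqÑ (fin a) (fin b) = a ℕ.≡ᵇ b
eqÑ ε ε = true
eqÑ _ _ = false

-- monomials in x₁,…,x_N (index j : ℕ, j < N, stands for x_{j+1})
Mono : ℕ → Set
Mono N = Vec Ñ N

one : ∀ {N} → Mono N
one = V.replicate _ (fin 0)

mulM : ∀ {N} → Mono N → Mono N → Mono N
mulM = zipWith _⊕_

xpow : ∀ {N} → ℕ → Ñ → Mono N
xpow j e = tabulate (λ i → if toℕ i ℕ.≡ᵇ j then e else fin 0)

eqMono : ∀ {N} → Mono N → Mono N → Bool
eqMono V.[] V.[] = true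
eqMono (a V.∷ as) (b V.∷ bs) = eqÑ a b ∧ eqMono as bs

Poly : ℕ → Set
Poly N = List (ℤ × Mono N)

_*P_ : ∀ {N} → Poly N → Poly N → Poly N
p *P q = concatMap (λ { (c , m) → map (λ { (d , m') → (c ℤ.* d , mulM m m') }) q }) p

scaleP : ∀ {N} → ℤ → Poly N → Poly N
scaleP a = map (λ { (c , m) → (a ℤ.* c , m) })

coeff : ∀ {N} → Mono N → Poly N → ℤ
coeff μ = foldr (λ { (c , m) r → if eqMono m μ then c ℤ.+ r else r }) (+ 0)

data RPart : Set where
  εp   : RPart
  part : ℕ → RPart      -- part k is the positive integer suc k

-- (e_p , [p ∈ D(α)])
expand : List RPart → List (Ñ × Bool)
expand [] = []
expand (εp ∷ α) = (ε , false) ∷ expand α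
expand (part k ∷ α) = replicate k (fin 1 , false) ++ ((fin 1 , true) ∷ expand α)

-- all monomials x_{j₁}^{e₁}⋯ with lo ≤ j₁ ≤ j₂ ≤ ⋯ < N, strict after descent positions
gen : (N : ℕ) → List (Ñ × Bool) → ℕ → List (Mono N)
gen N [] lo = one ∷ []
gen N ((e , d) ∷ rest) lo =
  concatMap (λ j → map (mulM (xpow j e)) (gen N rest (if d then suc j else j))) (drop lo (upTo N))

-- F_α(x₁,…,x_N,0,0,…)
F : (N : ℕ) → List RPart → Poly N
F N α = map (λ m → (+ 1 , m)) (gen N (expand α) 0)

compGo : ℕ → ℕ → List ℕ → List RPart   -- previous letter, current block length − 1
compGo prev k [] = part k ∷ []
compGo prev k (x ∷ xs) = if x ℕ.<ᵇ prev then part k ∷ compGo x 0 xs else compGo x (suc k) xs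

comp : List ℕ → List RPart
comp [] = []
comp (x ∷ xs) = compGo x 0 xs

wGo : List ℕ → List ℤ → List RPart
wGo run [] = comp run
wGo run (-[1+ _ ] ∷ xs) = comp run ++ (εp ∷ wGo [] xs)
wGo run (+ n ∷ xs) = wGo (run ++ (n ∷ [])) xs

wcomp : List ℤ → List RPart
wcomp = wGo []

-- F_{wcomp τ} is the generating function of the fillings of τ: cut τ into consecutive
-- segments placed in weakly increasing variables, where inside a segment a negative letter
-- may be followed by anything and a positive letter only by a positive letter that is not
-- smaller.  This depends only on the signs and descents of τ, which standardization and
-- σ ↦ σ[m] preserve.  For π and σ[m] (all positive letters of σ[m] exceed those of π) the
-- product of the two filling sums is the filling sum of π ⋆₋₁ σ[m]: peel off the first
-- variable and compare, for the two first letters, the ways its segment can take them; two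
-- negative first letters are counted twice, which the −(a•b) term of ⋆₋₁ corrects.
-- Finally each standardized word occurs exactly once among the signed permutations of size
-- at most m + n.

module Submission where

open import Defs
open import Data.Bool using (Bool; true; false; if_then_else_; _∧_; _∨_; not; T)
open import Data.Bool.Properties using (if-eta; T-≡; ∨-zeroʳ)
open import Data.Fin using (Fin; toℕ)
open import Data.Integer as ℤ using (ℤ; +_; -[1+_]; ∣_∣; _+_; _*_; -_)
import Data.Integer.Properties as ℤP
open import Data.Integer.Tactic.RingSolver using (solve-∀)
open import Data.List using (List; []; _∷_; _++_; _∷ʳ_; map; concatMap; length; upTo; drop; replicate; foldr; zip; applyUpTo)
import Data.List.Properties as ListP
open import Data.List.Membership.Propositional using (_∈_; _∉_)
import Data.List.Membership.Propositional.Properties as ListMP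
open import Data.List.Relation.Binary.Permutation.Propositional using (_↭_; ↭-refl; ↭-sym; ↭-trans)
import Data.List.Relation.Binary.Permutation.Propositional as Perm
import Data.List.Relation.Binary.Permutation.Propositional.Properties as PermP
open import Data.List.Relation.Binary.Subset.Propositional using (_⊆_)
open import Data.List.Relation.Unary.All as All using (All; []; _∷_)
import Data.List.Relation.Unary.All.Properties as AllP
open import Data.List.Relation.Unary.AllPairs using (AllPairs)
import Data.List.Relation.Unary.AllPairs.Properties as AllPairsP
open import Data.List.Relation.Unary.Any using (here; there)
open import Data.List.Relation.Unary.Linked using (Linked; []; [-]; _∷_)
open import Data.List.Relation.Unary.Unique.Propositional using (Unique; []; _∷_)
import Data.List.Relation.Unary.Unique.Propositional.Properties as UniqueP
open import Data.Nat as ℕ using (ℕ; zero; suc)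
import Data.Nat.Properties as ℕP
open import Data.List.Membership.DecPropositional ℕ._≟_ using (_∈?_)
open import Data.Product using (_×_; _,_; proj₁; proj₂)
open import Data.Product.Relation.Binary.Lex.Strict using (×-strictTotalOrder)
open import Data.Sum using (inj₁; inj₂)
open import Data.Unit using (⊤; tt)
open import Data.Vec as Vec using (zipWith; tabulate)
import Data.Vec.Properties as VecP
open import Function using (_∘_; Equivalence)
open import Relation.Binary.Bundles using (StrictTotalOrder)
open import Relation.Binary.Definitions using (tri<; tri≈; tri>; DecidableEquality)
open import Relation.Binary.PropositionalEquality
open import Relation.Nullary using (Dec; contradiction; yes; no; does)
open import Relation.Nullary.Decidable using (dec-true; dec-false)

⊕-identityˡ : ∀ x → fin 0 ⊕ x ≡ x
⊕-identityˡ (fin a) = refl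
⊕-identityˡ ε       = refl

⊕-comm : ∀ x y → x ⊕ y ≡ y ⊕ x
⊕-comm (fin a)       (fin b)       = cong fin (ℕP.+-comm a b)
⊕-comm (fin zero)    ε             = refl
⊕-comm (fin (suc a)) ε             = refl
⊕-comm ε             (fin zero)    = refl
⊕-comm ε             (fin (suc b)) = refl
⊕-comm ε             ε             = refl

⊕-assoc : ∀ x y z → (x ⊕ y) ⊕ z ≡ x ⊕ (y ⊕ z)
⊕-assoc (fin zero)    y             z             = trans (cong (_⊕ z) (⊕-identityˡ y)) (sym (⊕-identityˡ (y ⊕ z)))
⊕-assoc (fin a)       (fin b)       (fin c)       = cong fin (ℕP.+-assoc a b c)
⊕-assoc (fin (suc a)) (fin zero)    ε             = cong (fin ∘ suc) (ℕP.+-identityʳ a)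
⊕-assoc (fin (suc a)) (fin (suc b)) ε             = refl
⊕-assoc (fin (suc a)) ε             (fin zero)    = cong (fin ∘ suc) (ℕP.+-identityʳ a)
⊕-assoc (fin (suc a)) ε             (fin (suc c)) = refl
⊕-assoc (fin (suc a)) ε             ε             = refl
⊕-assoc ε             (fin zero)    z             = cong (ε ⊕_) (sym (⊕-identityˡ z))
⊕-assoc ε             (fin (suc b)) (fin c)       = refl
⊕-assoc ε             (fin (suc b)) ε             = refl
⊕-assoc ε             ε             (fin zero)    = refl
⊕-assoc ε             ε             (fin (suc c)) = refl
⊕-assoc ε             ε             ε             = refl

⊕-swapʳ : ∀ x y z → (x ⊕ y) ⊕ z ≡ (x ⊕ z) ⊕ y
⊕-swapʳ x y z = trans (⊕-assoc x y z) (trans (cong (x ⊕_) (⊕-comm y z)) (sym (⊕-assoc x z y)))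

mulM-assoc : ∀ {N} (a b c : Mono N) → mulM (mulM a b) c ≡ mulM a (mulM b c)
mulM-assoc = VecP.zipWith-assoc ⊕-assoc

mulM-comm : ∀ {N} (a b : Mono N) → mulM a b ≡ mulM b a
mulM-comm = VecP.zipWith-comm ⊕-comm

mulM-identityˡ : ∀ {N} (a : Mono N) → mulM one a ≡ a
mulM-identityˡ = VecP.zipWith-identityˡ ⊕-identityˡ

xpow-zero : ∀ {N} j → xpow {N} j (fin 0) ≡ one
xpow-zero {N} j = trans (VecP.tabulate-cong (λ i → if-eta (toℕ i ℕ.≡ᵇ j))) (tabulate-const N)
  where
  tabulate-const : ∀ M → tabulate {n = M} (λ _ → fin 0) ≡ Vec.replicate M (fin 0)
  tabulate-const zero    = refl
  tabulate-const (suc M) = cong (fin 0 Vec.∷_) (tabulate-const M)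

xpow-⊕ : ∀ {N} j a b → mulM (xpow {N} j a) (xpow j b) ≡ xpow j (a ⊕ b)
xpow-⊕ {N} j a b = go (λ i → toℕ i ℕ.≡ᵇ j)
  where
  pointwise : ∀ t → (if t then a else fin 0) ⊕ (if t then b else fin 0) ≡ (if t then a ⊕ b else fin 0)
  pointwise true  = refl
  pointwise false = refl
  go : ∀ {M} (t : Fin M → Bool) →
       zipWith _⊕_ (tabulate (λ i → if t i then a else fin 0)) (tabulate (λ i → if t i then b else fin 0))
         ≡ tabulate (λ i → if t i then a ⊕ b else fin 0)
  go {zero}  t = refl
  go {suc M} t = cong₂ Vec._∷_ (pointwise (t Data.Fin.zero)) (go (t ∘ Data.Fin.suc))

T⇒≡true : ∀ {b} → T b → b ≡ true
T⇒≡true = Equivalence.to T-≡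

≡true⇒T : ∀ {b} → b ≡ true → T b
≡true⇒T = Equivalence.from T-≡

<⇒<ᵇ≡true : ∀ {m n} → m ℕ.< n → (m ℕ.<ᵇ n) ≡ true
<⇒<ᵇ≡true lt = T⇒≡true (ℕP.<⇒<ᵇ lt)

<⇒>ᵇ≡false : ∀ {m n} → m ℕ.< n → (n ℕ.<ᵇ m) ≡ false
<⇒>ᵇ≡false {m} {n} lt with n ℕ.<ᵇ m in e
... | false = refl
... | true  = contradiction (ℕP.<ᵇ⇒< n m (≡true⇒T e)) (ℕP.<⇒≯ lt)

<ᵇ≡false-mono : ∀ {p n c} → (p ℕ.<ᵇ c) ≡ false → p ℕ.< n → (n ℕ.<ᵇ c) ≡ false
<ᵇ≡false-mono {p} {n} {c} e lt with n ℕ.<ᵇ c in e′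
... | false = refl
... | true  = contradiction (trans (sym (<⇒<ᵇ≡true (ℕP.<-trans lt (ℕP.<ᵇ⇒< n c (≡true⇒T e′))))) e) λ ()

<ᵇ-cong-⇔ : ∀ {a b c d} → (a ℕ.< b → c ℕ.< d) → (c ℕ.< d → a ℕ.< b) → (a ℕ.<ᵇ b) ≡ (c ℕ.<ᵇ d)
<ᵇ-cong-⇔ {a} {b} {c} {d} to from with a ℕ.<ᵇ b in ab | c ℕ.<ᵇ d in cd
... | true  | true  = refl
... | false | false = refl
... | true  | false = contradiction (trans (sym (<⇒<ᵇ≡true (to (ℕP.<ᵇ⇒< a b (≡true⇒T ab))))) cd) λ ()
... | false | true  = contradiction (trans (sym (<⇒<ᵇ≡true (from (ℕP.<ᵇ⇒< c d (≡true⇒T cd))))) ab) λ ()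

∑ : ∀ {A : Set} → List A → (A → ℤ) → ℤ
∑ []       f = + 0
∑ (x ∷ xs) f = f x + ∑ xs f

∑-++ : ∀ {A : Set} (xs ys : List A) f → ∑ (xs ++ ys) f ≡ ∑ xs f + ∑ ys f
∑-++ []       ys f = sym (ℤP.+-identityˡ _)
∑-++ (x ∷ xs) ys f = trans (cong (_+_ (f x)) (∑-++ xs ys f)) (sym (ℤP.+-assoc (f x) _ _))

∑-concatMap : ∀ {A B : Set} (g : A → List B) (xs : List A) f → ∑ (concatMap g xs) f ≡ ∑ xs (λ x → ∑ (g x) f)
∑-concatMap g []       f = refl
∑-concatMap g (x ∷ xs) f = trans (∑-++ (g x) (concatMap g xs) f) (cong (_+_ (∑ (g x) f)) (∑-concatMap g xs f))

∑-map : ∀ {A B : Set} (g : A → B) (xs : List A) f → ∑ (map g xs) f ≡ ∑ xs (f ∘ g)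
∑-map g []       f = refl
∑-map g (x ∷ xs) f = cong (_+_ (f (g x))) (∑-map g xs f)

∑-cong : ∀ {A : Set} (xs : List A) {f g : A → ℤ} → (∀ x → f x ≡ g x) → ∑ xs f ≡ ∑ xs g
∑-cong []       e = refl
∑-cong (x ∷ xs) e = cong₂ _+_ (e x) (∑-cong xs e)

∑-cong-All : ∀ {A : Set} {P : A → Set} {xs} → All P xs → {f g : A → ℤ} → (∀ x → P x → f x ≡ g x) → ∑ xs f ≡ ∑ xs g
∑-cong-All []       e = refl
∑-cong-All (p ∷ ps) e = cong₂ _+_ (e _ p) (∑-cong-All ps e)

∑-distrib-+ : ∀ {A : Set} (xs : List A) f g → ∑ xs (λ x → f x + g x) ≡ ∑ xs f + ∑ xs g
∑-distrib-+ []       f g = refl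
∑-distrib-+ (x ∷ xs) f g = trans (cong (_+_ (f x + g x)) (∑-distrib-+ xs f g)) (interchange (f x) (g x) (∑ xs f) (∑ xs g))
  where
  interchange : ∀ a b c d → (a + b) + (c + d) ≡ (a + c) + (b + d)
  interchange = solve-∀

∑-*ˡ : ∀ {A : Set} (xs : List A) c f → ∑ xs (λ x → c * f x) ≡ c * ∑ xs f
∑-*ˡ []       c f = sym (ℤP.*-zeroʳ c)
∑-*ˡ (x ∷ xs) c f = trans (cong (_+_ (c * f x)) (∑-*ˡ xs c f)) (sym (ℤP.*-distribˡ-+ c (f x) _))

∑-*ʳ : ∀ {A : Set} (xs : List A) f c → ∑ xs (λ x → f x * c) ≡ ∑ xs f * c
∑-*ʳ xs f c = trans (∑-cong xs (λ x → ℤP.*-comm (f x) c)) (trans (∑-*ˡ xs c f) (ℤP.*-comm c _))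

∑-zero : ∀ {A : Set} (xs : List A) → ∑ xs (λ _ → + 0) ≡ + 0
∑-zero []       = refl
∑-zero (x ∷ xs) = trans (ℤP.+-identityˡ _) (∑-zero xs)

∑-neg : ∀ {A : Set} (xs : List A) f → ∑ xs (λ x → - f x) ≡ - ∑ xs f
∑-neg []       f = refl
∑-neg (x ∷ xs) f = trans (cong (_+_ (- f x)) (∑-neg xs f)) (sym (ℤP.neg-distrib-+ (f x) _))

∑-comm : ∀ {A B : Set} (xs : List A) (ys : List B) (f : A → B → ℤ) →
         ∑ xs (λ x → ∑ ys (f x)) ≡ ∑ ys (λ y → ∑ xs (λ x → f x y))
∑-comm []       ys f = sym (∑-zero ys)
∑-comm (x ∷ xs) ys f = trans (cong (_+_ (∑ ys (f x))) (∑-comm xs ys f)) (sym (∑-distrib-+ ys (f x) _))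

infixr 7 [_]·_
[_]·_ : Bool → ℤ → ℤ
[ b ]· x = if b then x else + 0

[]·-distrib-+ : ∀ b x y → [ b ]· (x + y) ≡ [ b ]· x + [ b ]· y
[]·-distrib-+ true  x y = refl
[]·-distrib-+ false x y = refl

[]·-zero : ∀ b → [ b ]· + 0 ≡ + 0
[]·-zero b = if-eta b

[]·-comm : ∀ b c x → [ b ]· [ c ]· x ≡ [ c ]· [ b ]· x
[]·-comm true  c     x = refl
[]·-comm false true  x = refl
[]·-comm false false x = refl

[]·-∧ : ∀ a b → [ a ∧ b ]· + 1 ≡ [ a ]· [ b ]· + 1
[]·-∧ true  b = refl
[]·-∧ false b = refl

∑-[]· : ∀ {A : Set} (xs : List A) b f → ∑ xs (λ x → [ b ]· f x) ≡ [ b ]· ∑ xs f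
∑-[]· xs true  f = refl
∑-[]· xs false f = ∑-zero xs

δ : ∀ {N} → Mono N → Mono N → ℤ
δ μ m = [ eqMono m μ ]· + 1

pairP : ∀ {N} → Poly N → (Mono N → ℤ) → ℤ
pairP p φ = ∑ p (λ (c , m) → c * φ m)

coeff≡pairP-δ : ∀ {N} (μ : Mono N) p → coeff μ p ≡ pairP p (δ μ)
coeff≡pairP-δ μ []            = refl
coeff≡pairP-δ μ ((c , m) ∷ p) with eqMono m μ
... | true  = cong₂ _+_ (sym (ℤP.*-identityʳ c)) (coeff≡pairP-δ μ p)
... | false = trans (coeff≡pairP-δ μ p) (sym (trans (cong (_+ pairP p (δ μ)) (ℤP.*-zeroʳ c)) (ℤP.+-identityˡ _)))

pairP-cong : ∀ {N} (p : Poly N) {φ ψ : Mono N → ℤ} → (∀ m → φ m ≡ ψ m) → pairP p φ ≡ pairP p ψ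
pairP-cong p e = ∑-cong p (λ (c , m) → cong (c *_) (e m))

pairP-*P : ∀ {N} (p q : Poly N) φ → pairP (p *P q) φ ≡ pairP p (λ m → pairP q (λ m′ → φ (mulM m m′)))
pairP-*P p q φ = trans (∑-concatMap _ p _) (∑-cong p λ (c , m) → trans (∑-map _ q _)
  (trans (∑-cong q (λ (d , m′) → ℤP.*-assoc c d _)) (∑-*ˡ q c _)))

pairP-scaleP : ∀ {N} a (p : Poly N) φ → pairP (scaleP a p) φ ≡ a * pairP p φ
pairP-scaleP a p φ = trans (∑-map _ p _) (trans (∑-cong p (λ (c , m) → ℤP.*-assoc a c _)) (∑-*ˡ p a _))

pairP-concatMap : ∀ {A : Set} {N} (f : A → Poly N) xs φ → pairP (concatMap f xs) φ ≡ ∑ xs (λ x → pairP (f x) φ)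
pairP-concatMap f xs φ = ∑-concatMap f xs _

pairP-F : ∀ N α φ → pairP (F N α) φ ≡ ∑ (gen N (expand α) 0) φ
pairP-F N α φ = trans (∑-map _ (gen N (expand α) 0) _) (∑-cong (gen N (expand α) 0) (λ m → ℤP.*-identityˡ (φ m)))

pairLC : LC → (List ℤ → ℤ) → ℤ
pairLC X g = ∑ X (λ (c , w) → c * g w)

pairLC-distrib-+ : ∀ X f g → pairLC X (λ w → f w + g w) ≡ pairLC X f + pairLC X g
pairLC-distrib-+ X f g = trans (∑-cong X (λ (c , w) → ℤP.*-distribˡ-+ c _ _)) (∑-distrib-+ X _ _)

pairLC-zero : ∀ X → pairLC X (λ _ → + 0) ≡ + 0
pairLC-zero X = trans (∑-cong X (λ (c , w) → ℤP.*-zeroʳ c)) (∑-zero X)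

pairLC-[]· : ∀ X b f → pairLC X (λ w → [ b ]· f w) ≡ [ b ]· pairLC X f
pairLC-[]· X true  f = refl
pairLC-[]· X false f = pairLC-zero X

pairLC-singleton : ∀ w g → pairLC ((+ 1 , w) ∷ []) g ≡ g w
pairLC-singleton w g = trans (ℤP.+-identityʳ _) (ℤP.*-identityˡ (g w))

pairLC-prep : ∀ a X g → pairLC (prep a X) g ≡ pairLC X (λ w → g (a ∷ w))
pairLC-prep a X g = ∑-map _ X _

pairLC-star-∷ : ∀ a u b v g → pairLC (star (a ∷ u) (b ∷ v)) g ≡
  pairLC (star u (b ∷ v)) (λ w → g (a ∷ w)) + pairLC (star (a ∷ u) v) (λ w → g (b ∷ w)) +
  [ isNeg a ∧ isNeg b ]· (- pairLC (star u v) (λ w → g (a ∷ w)))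
pairLC-star-∷ a u b v g = begin
  pairLC (prep a X ++ prep b Y ++ Z) g
    ≡⟨ ∑-++ (prep a X) (prep b Y ++ Z) _ ⟩
  pairLC (prep a X) g + pairLC (prep b Y ++ Z) g
    ≡⟨ cong (_+_ (pairLC (prep a X) g)) (∑-++ (prep b Y) Z _) ⟩
  pairLC (prep a X) g + (pairLC (prep b Y) g + pairLC Z g)
    ≡⟨ sym (ℤP.+-assoc (pairLC (prep a X) g) _ _) ⟩
  pairLC (prep a X) g + pairLC (prep b Y) g + pairLC Z g
    ≡⟨ cong₂ _+_ (cong₂ _+_ (pairLC-prep a X g) (pairLC-prep b Y g)) (negated (isNeg a ∧ isNeg b)) ⟩
  pairLC X (λ w → g (a ∷ w)) + pairLC Y (λ w → g (b ∷ w)) + [ isNeg a ∧ isNeg b ]· (- pairLC W (λ w → g (a ∷ w))) ∎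
  where
  open ≡-Reasoning
  X = star u (b ∷ v)
  Y = star (a ∷ u) v
  W = star u v
  Z = if isNeg a ∧ isNeg b then map (λ (c , w) → (- c , a ∷ w)) W else []
  negated : ∀ t → pairLC (if t then map (λ (c , w) → (- c , a ∷ w)) W else []) g
                  ≡ [ t ]· (- pairLC W (λ w → g (a ∷ w)))
  negated true  = trans (∑-map _ W _) (trans (∑-cong W (λ (c , w) → sym (ℤP.neg-distribˡ-* c _))) (∑-neg W _))
  negated false = refl

-- Shapes of words

mutual
  shape : List ℤ → List (Ñ × Bool)
  shape []               = []
  shape (-[1+ _ ] ∷ ys)  = (ε , false) ∷ shape ys
  shape (+ n ∷ ys)       = shapeAfter n ys

  shapeAfter : ℕ → List ℤ → List (Ñ × Bool)
  shapeAfter p []              = (fin 1 , true) ∷ []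
  shapeAfter p (-[1+ _ ] ∷ ys) = (fin 1 , true) ∷ (ε , false) ∷ shape ys
  shapeAfter p (+ n ∷ ys)      = (fin 1 , (n ℕ.<ᵇ p)) ∷ shapeAfter n ys

runShape : ℕ → List ℕ → List (Ñ × Bool)
runShape p []       = []
runShape p (x ∷ xs) = (fin 1 , (x ℕ.<ᵇ p)) ∷ runShape x xs

lastOf : ℕ → List ℕ → ℕ
lastOf p []       = p
lastOf p (x ∷ xs) = lastOf x xs

runShape-∷ʳ : ∀ p xs n → runShape p (xs ++ n ∷ []) ≡ runShape p xs ++ (fin 1 , (n ℕ.<ᵇ lastOf p xs)) ∷ []
runShape-∷ʳ p []       n = refl
runShape-∷ʳ p (x ∷ xs) n = cong (_ ∷_) (runShape-∷ʳ x xs n)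

lastOf-∷ʳ : ∀ p xs n → lastOf p (xs ++ n ∷ []) ≡ n
lastOf-∷ʳ p []       n = refl
lastOf-∷ʳ p (x ∷ xs) n = lastOf-∷ʳ x xs n

expand-compGo : ∀ prev k xs R → expand (compGo prev k xs ++ R)
                ≡ replicate k (fin 1 , false) ++ runShape prev xs ++ (fin 1 , true) ∷ expand R
expand-compGo prev k []       R = refl
expand-compGo prev k (x ∷ xs) R with x ℕ.<ᵇ prev
... | true  = cong (λ z → replicate k (fin 1 , false) ++ (fin 1 , true) ∷ z) (expand-compGo x 0 xs R)
... | false = trans (expand-compGo x (suc k) xs R) (replicate-suc k)
  where
  replicate-suc : ∀ {A : Set} {a : A} {l} k → replicate (suc k) a ++ l ≡ replicate k a ++ a ∷ l
  replicate-suc zero    = refl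
  replicate-suc (suc k) = cong (_ ∷_) (replicate-suc k)

mutual
  expand-wGo-run : ∀ x rs ys → expand (wGo (x ∷ rs) ys) ≡ runShape x rs ++ shapeAfter (lastOf x rs) ys
  expand-wGo-run x rs [] = begin
    expand (compGo x 0 rs)                                   ≡⟨ cong expand (sym (ListP.++-identityʳ (compGo x 0 rs))) ⟩
    expand (compGo x 0 rs ++ [])                             ≡⟨ expand-compGo x 0 rs [] ⟩
    runShape x rs ++ (fin 1 , true) ∷ []                     ∎
    where open ≡-Reasoning
  expand-wGo-run x rs (-[1+ k ] ∷ ys) = begin
    expand (compGo x 0 rs ++ εp ∷ wGo [] ys)                 ≡⟨ expand-compGo x 0 rs _ ⟩
    runShape x rs ++ (fin 1 , true) ∷ (ε , false) ∷ expand (wGo [] ys)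
      ≡⟨ cong (λ z → runShape x rs ++ (fin 1 , true) ∷ (ε , false) ∷ z) (expand-wGo ys) ⟩
    runShape x rs ++ shapeAfter (lastOf x rs) (-[1+ k ] ∷ ys) ∎
    where open ≡-Reasoning
  expand-wGo-run x rs (+ n ∷ ys) = begin
    expand (wGo (x ∷ rs ++ n ∷ []) ys)                       ≡⟨ expand-wGo-run x (rs ++ n ∷ []) ys ⟩
    runShape x (rs ++ n ∷ []) ++ shapeAfter (lastOf x (rs ++ n ∷ [])) ys
      ≡⟨ cong₂ _++_ (runShape-∷ʳ x rs n) (cong (λ z → shapeAfter z ys) (lastOf-∷ʳ x rs n)) ⟩
    (runShape x rs ++ (fin 1 , (n ℕ.<ᵇ lastOf x rs)) ∷ []) ++ shapeAfter n ys
      ≡⟨ ListP.++-assoc (runShape x rs) _ _ ⟩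
    runShape x rs ++ shapeAfter (lastOf x rs) (+ n ∷ ys)     ∎
    where open ≡-Reasoning

  expand-wGo : ∀ ys → expand (wGo [] ys) ≡ shape ys
  expand-wGo []              = refl
  expand-wGo (-[1+ k ] ∷ ys) = cong ((ε , false) ∷_) (expand-wGo ys)
  expand-wGo (+ n ∷ ys)      = expand-wGo-run n [] ys

expand-wcomp : ∀ ys → expand (wcomp ys) ≡ shape ys
expand-wcomp = expand-wGo

-- Filling sums

-- The state of a segment: free when empty or after a negative letter, asc c after the
-- positive letter c; closed admits no further letter.
data Run : Set where
  free   : Run
  asc    : ℕ → Run
  closed : Run

extends : Run → ℤ → Bool
extends free     _         = true
extends (asc c)  (+ n)     = not (n ℕ.<ᵇ c)
extends (asc c)  -[1+ _ ]  = false
extends closed   _         = false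

runAfter : ℤ → Run
runAfter (+ n)     = asc n
runAfter -[1+ _ ]  = free

exponent : ℤ → Ñ
exponent (+ _)     = fin 1
exponent -[1+ _ ]  = ε

drop-applyUpTo : ∀ {A : Set} (f : ℕ → A) lo k → drop lo (applyUpTo f (lo ℕ.+ suc k)) ≡ f lo ∷ drop (suc lo) (applyUpTo f (lo ℕ.+ suc k))
drop-applyUpTo f zero     k = refl
drop-applyUpTo f (suc lo) k = drop-applyUpTo (f ∘ suc) lo k

drop-applyUpTo-all : ∀ {A : Set} (f : ℕ → A) n → drop n (applyUpTo f n) ≡ []
drop-applyUpTo-all f zero    = refl
drop-applyUpTo-all f (suc n) = drop-applyUpTo-all (f ∘ suc) n

module Fillings (N : ℕ) where

  timesX : ℕ → Ñ → Mono N → Mono N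
  timesX j e m = mulM (xpow j e) m

  timesX-zero : ∀ j m → timesX j (fin 0) m ≡ m
  timesX-zero j m = trans (cong (λ x → mulM x m) (xpow-zero j)) (mulM-identityˡ m)

  timesX-timesX : ∀ j a b m → timesX j a (timesX j b m) ≡ timesX j (a ⊕ b) m
  timesX-timesX j a b m = trans (sym (mulM-assoc (xpow j a) (xpow j b) m)) (cong (λ x → mulM x m) (xpow-⊕ j a b))

  timesX-mulM : ∀ j a b m m′ → mulM (timesX j a m) (timesX j b m′) ≡ timesX j (a ⊕ b) (mulM m m′)
  timesX-mulM j a b m m′ = begin
    mulM (mulM xa m) (mulM xb m′)   ≡⟨ mulM-assoc xa m _ ⟩
    mulM xa (mulM m (mulM xb m′))   ≡⟨ cong (mulM xa) (sym (mulM-assoc m xb m′)) ⟩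
    mulM xa (mulM (mulM m xb) m′)   ≡⟨ cong (λ x → mulM xa (mulM x m′)) (mulM-comm m xb) ⟩
    mulM xa (mulM (mulM xb m) m′)   ≡⟨ cong (mulM xa) (mulM-assoc xb m m′) ⟩
    mulM xa (mulM xb (mulM m m′))   ≡⟨ sym (mulM-assoc xa xb _) ⟩
    mulM (mulM xa xb) (mulM m m′)   ≡⟨ cong (λ x → mulM x (mulM m m′)) (xpow-⊕ j a b) ⟩
    timesX j (a ⊕ b) (mulM m m′)    ∎
    where
    open ≡-Reasoning
    xa = xpow {N} j a
    xb = xpow {N} j b

  -- fillSum k lo τ φ sums φ over the monomials obtained by cutting τ into k consecutive
  -- segments admissible for 'extends' and giving the i-th segment to x_{lo+i}; in
  -- fillSumFrom, x_lo already carries exponent acc and its segment is in state q.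
  mutual
    fillSum : ℕ → ℕ → List ℤ → (Mono N → ℤ) → ℤ
    fillSum zero    lo []      φ = φ one
    fillSum zero    lo (_ ∷ _) φ = + 0
    fillSum (suc k) lo τ       φ = fillSumFrom k lo (fin 0) free τ φ

    fillSumFrom : ℕ → ℕ → Ñ → Run → List ℤ → (Mono N → ℤ) → ℤ
    fillSumFrom k lo acc q []      φ = fillSum k (suc lo) [] (φ ∘ timesX lo acc)
    fillSumFrom k lo acc q (a ∷ τ) φ = fillSum k (suc lo) (a ∷ τ) (φ ∘ timesX lo acc) +
      [ extends q a ]· fillSumFrom k lo (acc ⊕ exponent a) (runAfter a) τ φ

  mutual
    fillSum-cong : ∀ k lo τ {φ ψ : Mono N → ℤ} → (∀ m → φ m ≡ ψ m) → fillSum k lo τ φ ≡ fillSum k lo τ ψ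
    fillSum-cong zero    lo []      e = e one
    fillSum-cong zero    lo (_ ∷ _) e = refl
    fillSum-cong (suc k) lo τ       e = fillSumFrom-cong k lo (fin 0) free τ e

    fillSumFrom-cong : ∀ k lo acc q τ {φ ψ : Mono N → ℤ} → (∀ m → φ m ≡ ψ m) → fillSumFrom k lo acc q τ φ ≡ fillSumFrom k lo acc q τ ψ
    fillSumFrom-cong k lo acc q []      e = fillSum-cong k (suc lo) [] (e ∘ timesX lo acc)
    fillSumFrom-cong k lo acc q (a ∷ τ) e with extends q a
    ... | true  = cong₂ _+_ (fillSum-cong k (suc lo) (a ∷ τ) (e ∘ timesX lo acc)) (fillSumFrom-cong k lo _ _ τ e)
    ... | false = cong (_+ + 0) (fillSum-cong k (suc lo) (a ∷ τ) (e ∘ timesX lo acc))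

  ∑-gen-∷ : ∀ e d L lo φ → ∑ (gen N ((e , d) ∷ L) lo) φ
            ≡ ∑ (drop lo (upTo N)) (λ j → ∑ (gen N L (if d then suc j else j)) (φ ∘ timesX j e))
  ∑-gen-∷ e d L lo φ = trans (∑-concatMap _ (drop lo (upTo N)) φ) (∑-cong (drop lo (upTo N)) (λ j → ∑-map _ (gen N L _) φ))

  ∑-gen-∷-split : ∀ e d L lo k φ → lo ℕ.+ suc k ≡ N →
    ∑ (gen N ((e , d) ∷ L) lo) φ ≡ ∑ (gen N ((e , d) ∷ L) (suc lo)) φ + ∑ (gen N L (if d then suc lo else lo)) (φ ∘ timesX lo e)
  ∑-gen-∷-split e d L lo k φ refl = begin
    ∑ (gen N ((e , d) ∷ L) lo) φ                   ≡⟨ ∑-gen-∷ e d L lo φ ⟩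
    ∑ (drop lo (upTo N)) term                      ≡⟨ cong (λ js → ∑ js term) (drop-applyUpTo (λ j → j) lo k) ⟩
    term lo + ∑ (drop (suc lo) (upTo N)) term      ≡⟨ ℤP.+-comm (term lo) _ ⟩
    ∑ (drop (suc lo) (upTo N)) term + term lo      ≡⟨ cong (_+ term lo) (sym (∑-gen-∷ e d L (suc lo) φ)) ⟩
    ∑ (gen N ((e , d) ∷ L) (suc lo)) φ + term lo   ∎
    where
    open ≡-Reasoning
    term : ℕ → ℤ
    term j = ∑ (gen N L (if d then suc j else j)) (φ ∘ timesX j e)

  ∑-gen-∷-end : ∀ x L {φ} lo → lo ℕ.+ 0 ≡ N → ∑ (gen N (x ∷ L) lo) φ ≡ + 0
  ∑-gen-∷-end (e , d) L {φ} lo eq = trans (∑-gen-∷ e d L lo φ)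
    (cong (λ js → ∑ js (λ j → ∑ (gen N L (if d then suc j else j)) (φ ∘ timesX j e))) (dropAll lo (trans (sym (ℕP.+-identityʳ lo)) eq)))
    where
    dropAll : ∀ lo → lo ≡ N → drop lo (upTo N) ≡ []
    dropAll lo refl = drop-applyUpTo-all (λ j → j) lo

  ∑-gen-shape : ∀ k lo → lo ℕ.+ k ≡ N → ∀ τ φ → ∑ (gen N (shape τ) lo) φ ≡ fillSum k lo τ φ
  ∑-gen-shape zero lo eq []                   φ = ℤP.+-identityʳ (φ one)
  ∑-gen-shape zero lo eq (-[1+ _ ] ∷ τ)       φ = ∑-gen-∷-end (ε , false) (shape τ) lo eq
  ∑-gen-shape zero lo eq (+ _ ∷ [])           φ = ∑-gen-∷-end (fin 1 , true) [] lo eq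
  ∑-gen-shape zero lo eq (+ _ ∷ -[1+ _ ] ∷ τ) φ = ∑-gen-∷-end (fin 1 , true) ((ε , false) ∷ shape τ) lo eq
  ∑-gen-shape zero lo eq (+ p ∷ + n ∷ τ)      φ = ∑-gen-∷-end (fin 1 , (n ℕ.<ᵇ p)) (shapeAfter n τ) lo eq
  ∑-gen-shape (suc k) lo eq τ φ =
    trans (∑-cong (gen N (shape τ) lo) (λ m → cong φ (sym (timesX-zero lo m)))) (fromShape (fin 0) τ φ)
    where
    IH : ∀ τ φ → ∑ (gen N (shape τ) (suc lo)) φ ≡ fillSum k (suc lo) τ φ
    IH = ∑-gen-shape k (suc lo) (trans (sym (ℕP.+-suc lo k)) eq)
    split : ∀ e d L φ → ∑ (gen N ((e , d) ∷ L) lo) φ ≡ ∑ (gen N ((e , d) ∷ L) (suc lo)) φ + ∑ (gen N L (if d then suc lo else lo)) (φ ∘ timesX lo e)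
    split e d L φ = ∑-gen-∷-split e d L lo k φ eq
    merge : ∀ acc e L φ → ∑ L (φ ∘ timesX lo acc ∘ timesX lo e) ≡ ∑ L (φ ∘ timesX lo (acc ⊕ e))
    merge acc e L φ = ∑-cong L (λ m → cong φ (timesX-timesX lo acc e m))
    mutual
      fromShape : ∀ acc τ φ → ∑ (gen N (shape τ) lo) (φ ∘ timesX lo acc) ≡ fillSumFrom k lo acc free τ φ
      fromShape acc []              φ = IH [] _
      fromShape acc (-[1+ j ] ∷ τ)  φ = trans (split ε false (shape τ) _)
        (cong₂ _+_ (IH (-[1+ j ] ∷ τ) _) (trans (merge acc ε (gen N (shape τ) lo) φ) (fromShape (acc ⊕ ε) τ φ)))
      fromShape acc (+ p ∷ τ)       φ = fromShapeAfter acc p τ φ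

      fromShapeAfter : ∀ acc p τ φ → ∑ (gen N (shapeAfter p τ) lo) (φ ∘ timesX lo acc) ≡ fillSumFrom k lo acc free (+ p ∷ τ) φ
      fromShapeAfter acc p []             φ = trans (split (fin 1) true [] _)
        (cong₂ _+_ (IH (+ p ∷ []) _) (trans (merge acc (fin 1) (gen N [] (suc lo)) φ) (IH [] _)))
      fromShapeAfter acc p (-[1+ j ] ∷ τ) φ = trans (split (fin 1) true (shape (-[1+ j ] ∷ τ)) _)
        (cong₂ _+_ (IH (+ p ∷ -[1+ j ] ∷ τ) _)
          (trans (merge acc (fin 1) (gen N (shape (-[1+ j ] ∷ τ)) (suc lo)) φ)
            (trans (IH (-[1+ j ] ∷ τ) _) (sym (ℤP.+-identityʳ _)))))
      fromShapeAfter acc p (+ n ∷ τ)      φ with n ℕ.<ᵇ p in descent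
      ... | true  = trans (split (fin 1) true (shapeAfter n τ) _)
        (cong₂ _+_ (trans (cong (λ d → ∑ (gen N ((fin 1 , d) ∷ shapeAfter n τ) (suc lo)) (φ ∘ timesX lo acc)) (sym descent)) (IH (+ p ∷ + n ∷ τ) _))
          (trans (merge acc (fin 1) (gen N (shapeAfter n τ) (suc lo)) φ) (trans (IH (+ n ∷ τ) _) (sym (ℤP.+-identityʳ _)))))
      ... | false = trans (split (fin 1) false (shapeAfter n τ) _)
        (cong₂ _+_ (trans (cong (λ d → ∑ (gen N ((fin 1 , d) ∷ shapeAfter n τ) (suc lo)) (φ ∘ timesX lo acc)) (sym descent)) (IH (+ p ∷ + n ∷ τ) _))
          (trans (merge acc (fin 1) (gen N (shapeAfter n τ) lo) φ) (fromShapeAfter (acc ⊕ fin 1) n τ φ)))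

  mutual
    fillSum-distrib-+ : ∀ k lo τ f g → fillSum k lo τ (λ m → f m + g m) ≡ fillSum k lo τ f + fillSum k lo τ g
    fillSum-distrib-+ zero    lo []      f g = refl
    fillSum-distrib-+ zero    lo (_ ∷ _) f g = refl
    fillSum-distrib-+ (suc k) lo τ       f g = fillSumFrom-distrib-+ k lo (fin 0) free τ f g

    fillSumFrom-distrib-+ : ∀ k lo acc q τ f g → fillSumFrom k lo acc q τ (λ m → f m + g m) ≡ fillSumFrom k lo acc q τ f + fillSumFrom k lo acc q τ g
    fillSumFrom-distrib-+ k lo acc q []      f g = fillSum-distrib-+ k (suc lo) [] (f ∘ timesX lo acc) (g ∘ timesX lo acc)
    fillSumFrom-distrib-+ k lo acc q (a ∷ τ) f g = begin
      G (λ m → f m + g m) + [ c ]· W (λ m → f m + g m)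
        ≡⟨ cong₂ _+_ (fillSum-distrib-+ k (suc lo) (a ∷ τ) _ _) (cong ([ c ]·_) (fillSumFrom-distrib-+ k lo _ _ τ f g)) ⟩
      (G f + G g) + [ c ]· (W f + W g)
        ≡⟨ cong (_+_ (G f + G g)) ([]·-distrib-+ c (W f) (W g)) ⟩
      (G f + G g) + ([ c ]· W f + [ c ]· W g)
        ≡⟨ interchange (G f) (G g) _ _ ⟩
      (G f + [ c ]· W f) + (G g + [ c ]· W g) ∎
      where
      open ≡-Reasoning
      c = extends q a
      G W : (Mono N → ℤ) → ℤ
      G h = fillSum k (suc lo) (a ∷ τ) (h ∘ timesX lo acc)
      W h = fillSumFrom k lo (acc ⊕ exponent a) (runAfter a) τ h
      interchange : ∀ a b c d → (a + b) + (c + d) ≡ (a + c) + (b + d)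
      interchange = solve-∀

  mutual
    fillSum-zero : ∀ k lo τ → fillSum k lo τ (λ _ → + 0) ≡ + 0
    fillSum-zero zero    lo []      = refl
    fillSum-zero zero    lo (_ ∷ _) = refl
    fillSum-zero (suc k) lo τ       = fillSumFrom-zero k lo (fin 0) free τ

    fillSumFrom-zero : ∀ k lo acc q τ → fillSumFrom k lo acc q τ (λ _ → + 0) ≡ + 0
    fillSumFrom-zero k lo acc q []      = fillSum-zero k (suc lo) []
    fillSumFrom-zero k lo acc q (a ∷ τ) =
      cong₂ _+_ (fillSum-zero k (suc lo) (a ∷ τ))
                (trans (cong ([ extends q a ]·_) (fillSumFrom-zero k lo _ _ τ)) ([]·-zero (extends q a)))

  fillSum-[]· : ∀ k lo τ b f → fillSum k lo τ (λ m → [ b ]· f m) ≡ [ b ]· fillSum k lo τ f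
  fillSum-[]· k lo τ true  f = refl
  fillSum-[]· k lo τ false f = fillSum-zero k lo τ

-- The filling sum of a quasi-shuffle

PosBelow : ℤ → ℤ → Set
PosBelow (+ p) (+ n) = p ℕ.< n
PosBelow _     _     = ⊤

AllBelow : List ℤ → List ℤ → Set
AllBelow u v = All (λ x → All (PosBelow x) v) u

AllBelow-tailˡ : ∀ {a u v} → AllBelow (a ∷ u) v → AllBelow u v
AllBelow-tailˡ (_ ∷ below) = below

AllBelow-tailʳ : ∀ {u b v} → AllBelow u (b ∷ v) → AllBelow u v
AllBelow-tailʳ = All.map (λ { (_ ∷ below) → below })

AllBelow-head : ∀ {a u b v} → AllBelow (a ∷ u) (b ∷ v) → PosBelow a b
AllBelow-head ((below ∷ _) ∷ _) = below

-- With first letters a and b, the terms in which the segment of x_lo takes both letters,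
-- in either order, add up to those in which it takes both in the shuffled word.
crossTerms : ∀ q a b → PosBelow a b → ∀ X Y → (isNeg a ∧ isNeg b ≡ true → Y ≡ X) →
  [ extends q a ]· [ extends (runAfter a) b ]· X + [ extends q b ]· [ extends (runAfter b) a ]· X
    + [ isNeg a ∧ isNeg b ]· (- ([ extends q a ]· Y))
  ≡ [ extends q a ]· [ extends q b ]· X
crossTerms free     -[1+ _ ] -[1+ _ ] _  X Y Y≡X rewrite Y≡X refl = cancel X
  where
  cancel : ∀ X → X + X + - X ≡ X
  cancel = solve-∀
crossTerms free     -[1+ _ ] (+ n)    _  X Y _ = trans (ℤP.+-identityʳ _) (ℤP.+-identityʳ X)
crossTerms free     (+ p)    -[1+ _ ] _  X Y _ = trans (ℤP.+-identityʳ _) (ℤP.+-identityˡ X)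
crossTerms free     (+ p)    (+ n)    lt X Y _ rewrite <⇒>ᵇ≡false lt | <⇒<ᵇ≡true lt =
  trans (ℤP.+-identityʳ _) (ℤP.+-identityʳ X)
crossTerms (asc c)  -[1+ _ ] -[1+ _ ] _  X Y _ = refl
crossTerms (asc c)  -[1+ _ ] (+ n)    _  X Y _ = trans (ℤP.+-identityʳ _) (trans (ℤP.+-identityˡ _) ([]·-zero (not (n ℕ.<ᵇ c))))
crossTerms (asc c)  (+ p)    -[1+ _ ] _  X Y _ = trans (ℤP.+-identityʳ _) (ℤP.+-identityʳ _)
crossTerms (asc c)  (+ p)    (+ n)    lt X Y _ with p ℕ.<ᵇ c in p<c
... | true rewrite <⇒<ᵇ≡true lt = trans (ℤP.+-identityʳ _) (trans (ℤP.+-identityˡ _) ([]·-zero (not (n ℕ.<ᵇ c))))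
... | false rewrite <ᵇ≡false-mono {p} {n} {c} p<c lt | <⇒<ᵇ≡true lt | <⇒>ᵇ≡false lt = trans (ℤP.+-identityʳ _) (ℤP.+-identityʳ X)
crossTerms closed   a        b        _  X Y _ = trans (ℤP.+-identityˡ _) ([]·-zero (isNeg a ∧ isNeg b))

firstLetters-regroup : ∀ (t : Bool) a₁ a₂ b₁ b₂ c₁ c₂ → (a₁ + a₂) + (b₁ + b₂) + [ t ]· (- (c₁ + c₂))
                       ≡ (a₁ + b₁ + [ t ]· (- c₁)) + a₂ + b₂ + [ t ]· (- c₂)
firstLetters-regroup true = withCorrection
  where
  withCorrection : ∀ a₁ a₂ b₁ b₂ c₁ c₂ → (a₁ + a₂) + (b₁ + b₂) + - (c₁ + c₂) ≡ (a₁ + b₁ + - c₁) + a₂ + b₂ + - c₂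
  withCorrection = solve-∀
firstLetters-regroup false a₁ a₂ b₁ b₂ _ _ = withoutCorrection a₁ a₂ b₁ b₂
  where
  withoutCorrection : ∀ a₁ a₂ b₁ b₂ → (a₁ + a₂) + (b₁ + b₂) + + 0 ≡ (a₁ + b₁ + + 0) + a₂ + b₂ + + 0
  withoutCorrection = solve-∀

crossTerms-regroup : ∀ (α β ν : Bool) s p r t₁ t₂ y →
  s + [ α ]· (p + t₁) + [ β ]· (r + t₂) + [ ν ]· (- ([ α ]· y))
    ≡ (s + [ β ]· r + [ α ]· p) + ([ α ]· t₁ + [ β ]· t₂ + [ ν ]· (- ([ α ]· y)))
crossTerms-regroup α β ν s p r t₁ t₂ y
  rewrite []·-distrib-+ α p t₁ | []·-distrib-+ β r t₂ = ring s ([ α ]· p) ([ α ]· t₁) ([ β ]· r) ([ β ]· t₂) ([ ν ]· (- ([ α ]· y)))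
  where
  ring : ∀ s p t₁ r t₂ z → s + (p + t₁) + (r + t₂) + z ≡ (s + r + p) + (t₁ + t₂ + z)
  ring = solve-∀

module QuasiShuffle (N : ℕ) where
  open Fillings N

  module Step (k lo : ℕ) (φ : Mono N → ℤ)
    (IH : ∀ u v → AllBelow u v → ∀ ψ →
          fillSum k (suc lo) u (λ m → fillSum k (suc lo) v (λ m′ → ψ (mulM m m′)))
            ≡ pairLC (star u v) (λ w → fillSum k (suc lo) w ψ)) where

    rest : Ñ → List ℤ → ℤ
    rest acc s = fillSum k (suc lo) s (φ ∘ timesX lo acc)

    shuffleRest : Ñ → List ℤ → List ℤ → ℤ
    shuffleRest acc u v = pairLC (star u v) (rest acc)

    -- prefixSum acc q₁ u q₂ v adds shuffleRest (acc ⊕ exponents of u₁ v₁) u₂ v₂ over all splittings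
    -- u = u₁u₂, v = v₁v₂ in which u₁ (from state q₁) and v₁ (from state q₂) fit into x_lo.
    prefixSumʳ : Ñ → Run → List ℤ → List ℤ → ℤ
    prefixSumʳ acc q u []      = shuffleRest acc u []
    prefixSumʳ acc q u (b ∷ v) = shuffleRest acc u (b ∷ v) + [ extends q b ]· prefixSumʳ (acc ⊕ exponent b) (runAfter b) u v

    prefixSum : Ñ → Run → List ℤ → Run → List ℤ → ℤ
    prefixSum acc q₁ []      q₂ v = prefixSumʳ acc q₂ [] v
    prefixSum acc q₁ (a ∷ u) q₂ v = prefixSumʳ acc q₂ (a ∷ u) v + [ extends q₁ a ]· prefixSum (acc ⊕ exponent a) (runAfter a) u q₂ v

    shuffleRest-product : ∀ a₁ a₂ u v → AllBelow u v →
      fillSum k (suc lo) u (λ m → fillSum k (suc lo) v (λ m′ → φ (mulM (timesX lo a₁ m) (timesX lo a₂ m′))))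
        ≡ shuffleRest (a₁ ⊕ a₂) u v
    shuffleRest-product a₁ a₂ u v below =
      trans (fillSum-cong k (suc lo) u (λ m → fillSum-cong k (suc lo) v (λ m′ → cong φ (timesX-mulM lo a₁ a₂ m m′))))
            (IH u v below (φ ∘ timesX lo (a₁ ⊕ a₂)))

    prefixSumʳ-product : ∀ a₁ a₂ q u v → AllBelow u v →
      fillSum k (suc lo) u (λ m → fillSumFrom k lo a₂ q v (λ m′ → φ (mulM (timesX lo a₁ m) m′)))
        ≡ prefixSumʳ (a₁ ⊕ a₂) q u v
    prefixSumʳ-product a₁ a₂ q u []      below = shuffleRest-product a₁ a₂ u [] below
    prefixSumʳ-product a₁ a₂ q u (b ∷ v) below =
      trans (fillSum-distrib-+ k (suc lo) u _ _)
        (cong₂ _+_ (shuffleRest-product a₁ a₂ u (b ∷ v) below)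
          (trans (fillSum-[]· k (suc lo) u (extends q b) _)
            (cong ([ extends q b ]·_)
              (trans (prefixSumʳ-product a₁ (a₂ ⊕ exponent b) (runAfter b) u v (AllBelow-tailʳ below))
                     (cong (λ acc → prefixSumʳ acc (runAfter b) u v) (sym (⊕-assoc a₁ a₂ (exponent b))))))))

    prefixSum-product : ∀ a₁ q₁ a₂ q₂ u v → AllBelow u v →
      fillSumFrom k lo a₁ q₁ u (λ m → fillSumFrom k lo a₂ q₂ v (λ m′ → φ (mulM m m′)))
        ≡ prefixSum (a₁ ⊕ a₂) q₁ u q₂ v
    prefixSum-product a₁ q₁ a₂ q₂ []      v below = prefixSumʳ-product a₁ a₂ q₂ [] v below
    prefixSum-product a₁ q₁ a₂ q₂ (a ∷ u) v below =
      cong₂ _+_ (prefixSumʳ-product a₁ a₂ q₂ (a ∷ u) v below)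
        (cong ([ extends q₁ a ]·_)
          (trans (prefixSum-product (a₁ ⊕ exponent a) (runAfter a) a₂ q₂ u v (AllBelow-tailˡ below))
                 (cong (λ acc → prefixSum acc (runAfter a) u q₂ v) (⊕-swapʳ a₁ (exponent a) a₂))))

    prefixSum-∷ʳ : ∀ acc q₁ u q₂ b v →
      prefixSum acc q₁ u q₂ (b ∷ v)
        ≡ prefixSum acc q₁ u closed (b ∷ v) + [ extends q₂ b ]· prefixSum (acc ⊕ exponent b) q₁ u (runAfter b) v
    prefixSum-∷ʳ acc q₁ []      q₂ b v =
      cong (_+ [ extends q₂ b ]· prefixSumʳ (acc ⊕ exponent b) (runAfter b) [] v) (sym (ℤP.+-identityʳ (shuffleRest acc [] (b ∷ v))))
    prefixSum-∷ʳ acc q₁ (a ∷ u) q₂ b v = begin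
      (S + [ c ]· R) + [ α ]· prefixSum A (runAfter a) u q₂ (b ∷ v)
        ≡⟨ cong (_+_ (S + [ c ]· R)) (cong ([ α ]·_) (prefixSum-∷ʳ A (runAfter a) u q₂ b v)) ⟩
      (S + [ c ]· R) + [ α ]· (P + [ c ]· X)
        ≡⟨ cong (_+_ (S + [ c ]· R)) (trans ([]·-distrib-+ α P _) (cong (_+_ ([ α ]· P)) ([]·-comm α c X))) ⟩
      (S + [ c ]· R) + ([ α ]· P + [ c ]· [ α ]· X)
        ≡⟨ regroup S ([ c ]· R) ([ α ]· P) ([ c ]· [ α ]· X) ⟩
      ((S + + 0) + [ α ]· P) + ([ c ]· R + [ c ]· [ α ]· X)
        ≡⟨ cong (_+_ ((S + + 0) + [ α ]· P)) (sym ([]·-distrib-+ c R _)) ⟩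
      ((S + + 0) + [ α ]· P) + [ c ]· (R + [ α ]· X)
        ≡⟨ cong (λ acc′ → ((S + + 0) + [ α ]· P) + [ c ]· (R + [ α ]· prefixSum acc′ (runAfter a) u (runAfter b) v))
                (⊕-swapʳ acc (exponent a) (exponent b)) ⟩
      prefixSum acc q₁ (a ∷ u) closed (b ∷ v) + [ c ]· prefixSum (acc ⊕ exponent b) q₁ (a ∷ u) (runAfter b) v ∎
      where
      open ≡-Reasoning
      α = extends q₁ a
      c = extends q₂ b
      A = acc ⊕ exponent a
      S = shuffleRest acc (a ∷ u) (b ∷ v)
      R = prefixSumʳ (acc ⊕ exponent b) (runAfter b) (a ∷ u) v
      P = prefixSum A (runAfter a) u closed (b ∷ v)
      X = prefixSum (A ⊕ exponent b) (runAfter a) u (runAfter b) v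
      regroup : ∀ s r p x → (s + r) + (p + x) ≡ ((s + + 0) + p) + (r + x)
      regroup = solve-∀

    shuffleFill : Ñ → Run → List ℤ → List ℤ → ℤ
    shuffleFill acc q u v = pairLC (star u v) (λ w → fillSumFrom k lo acc q w φ)

    fillSumFrom≡prefixSumʳ : ∀ acc q v → fillSumFrom k lo acc q v φ ≡ prefixSumʳ acc q [] v
    fillSumFrom≡prefixSumʳ acc q []      = sym (pairLC-singleton [] (rest acc))
    fillSumFrom≡prefixSumʳ acc q (b ∷ v) =
      cong₂ _+_ (sym (pairLC-singleton (b ∷ v) (rest acc))) (cong ([ extends q b ]·_) (fillSumFrom≡prefixSumʳ _ _ v))

    fillSumFrom≡prefixSum : ∀ acc q₁ q₂ u → fillSumFrom k lo acc q₁ u φ ≡ prefixSum acc q₁ u q₂ []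
    fillSumFrom≡prefixSum acc q₁ q₂ []      = sym (pairLC-singleton [] (rest acc))
    fillSumFrom≡prefixSum acc q₁ q₂ (a ∷ u) =
      cong₂ _+_ (sym (pairLC-singleton (a ∷ u) (rest acc))) (cong ([ extends q₁ a ]·_) (fillSumFrom≡prefixSum _ _ q₂ u))

    shuffleFill-∷ : ∀ acc q a u b v →
      shuffleFill acc q (a ∷ u) (b ∷ v)
        ≡ shuffleRest acc (a ∷ u) (b ∷ v)
          + [ extends q a ]· shuffleFill (acc ⊕ exponent a) (runAfter a) u (b ∷ v)
          + [ extends q b ]· shuffleFill (acc ⊕ exponent b) (runAfter b) (a ∷ u) v
          + [ isNeg a ∧ isNeg b ]· (- ([ extends q a ]· shuffleFill (acc ⊕ exponent a) (runAfter a) u v))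
    shuffleFill-∷ acc q a u b v = begin
      shuffleFill acc q (a ∷ u) (b ∷ v)
        ≡⟨ pairLC-star-∷ a u b v (λ w → fillSumFrom k lo acc q w φ) ⟩
      pairLC X (fill a) + pairLC Y (fill b) + [ ν ]· (- pairLC W (fill a))
        ≡⟨ cong₂ _+_ (cong₂ _+_ (firstLetter a X) (firstLetter b Y)) (cong (λ z → [ ν ]· (- z)) (firstLetter a W)) ⟩
      (A₁ + A₂) + (B₁ + B₂) + [ ν ]· (- (C₁ + C₂))
        ≡⟨ firstLetters-regroup ν A₁ A₂ B₁ B₂ C₁ C₂ ⟩
      (A₁ + B₁ + [ ν ]· (- C₁)) + A₂ + B₂ + [ ν ]· (- C₂)
        ≡⟨ cong (λ z → z + A₂ + B₂ + [ ν ]· (- C₂)) (sym (pairLC-star-∷ a u b v (rest acc))) ⟩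
      shuffleRest acc (a ∷ u) (b ∷ v) + A₂ + B₂ + [ ν ]· (- C₂) ∎
      where
      open ≡-Reasoning
      ν = isNeg a ∧ isNeg b
      X = star u (b ∷ v)
      Y = star (a ∷ u) v
      W = star u v
      fill : ℤ → List ℤ → ℤ
      fill x w = fillSumFrom k lo acc q (x ∷ w) φ
      firstLetter : ∀ x Z → pairLC Z (fill x)
        ≡ pairLC Z (λ w → rest acc (x ∷ w)) + [ extends q x ]· pairLC Z (λ w → fillSumFrom k lo (acc ⊕ exponent x) (runAfter x) w φ)
      firstLetter x Z = trans (pairLC-distrib-+ Z _ _) (cong (_+_ (pairLC Z (λ w → rest acc (x ∷ w)))) (pairLC-[]· Z (extends q x) _))
      A₁ = pairLC X (λ w → rest acc (a ∷ w))
      B₁ = pairLC Y (λ w → rest acc (b ∷ w))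
      C₁ = pairLC W (λ w → rest acc (a ∷ w))
      A₂ = [ extends q a ]· shuffleFill (acc ⊕ exponent a) (runAfter a) u (b ∷ v)
      B₂ = [ extends q b ]· shuffleFill (acc ⊕ exponent b) (runAfter b) (a ∷ u) v
      C₂ = [ extends q a ]· shuffleFill (acc ⊕ exponent a) (runAfter a) u v

    prefixSum-doubleNegative : ∀ acc a b u v → isNeg a ∧ isNeg b ≡ true →
      prefixSum (acc ⊕ exponent a) (runAfter a) u (runAfter a) v
        ≡ prefixSum ((acc ⊕ exponent a) ⊕ exponent b) (runAfter a) u (runAfter b) v
    prefixSum-doubleNegative acc -[1+ _ ] -[1+ _ ] u v _ = cong (λ acc′ → prefixSum acc′ free u free v) (sym (⊕-assoc acc ε ε))

    shuffleFill-∷≡prefixSum : ∀ acc q a u b v → AllBelow (a ∷ u) (b ∷ v) →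
      shuffleFill (acc ⊕ exponent a) (runAfter a) u (b ∷ v) ≡ prefixSum (acc ⊕ exponent a) (runAfter a) u (runAfter a) (b ∷ v) →
      shuffleFill (acc ⊕ exponent b) (runAfter b) (a ∷ u) v ≡ prefixSum (acc ⊕ exponent b) (runAfter b) (a ∷ u) (runAfter b) v →
      shuffleFill (acc ⊕ exponent a) (runAfter a) u v ≡ prefixSum (acc ⊕ exponent a) (runAfter a) u (runAfter a) v →
      shuffleFill acc q (a ∷ u) (b ∷ v) ≡ prefixSum acc q (a ∷ u) q (b ∷ v)
    shuffleFill-∷≡prefixSum acc q a u b v below IHˡ IHʳ IHᵐ = begin
      shuffleFill acc q (a ∷ u) (b ∷ v)
        ≡⟨ shuffleFill-∷ acc q a u b v ⟩
      S + [ α ]· shuffleFill A ra u (b ∷ v) + [ β ]· shuffleFill B rb (a ∷ u) v + [ ν ]· (- ([ α ]· shuffleFill A ra u v))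
        ≡⟨ cong₂ _+_ (cong₂ _+_ (cong (λ z → S + [ α ]· z) IHˡ) (cong ([ β ]·_) IHʳ)) (cong (λ z → [ ν ]· (- ([ α ]· z))) IHᵐ) ⟩
      S + [ α ]· prefixSum A ra u ra (b ∷ v) + [ β ]· prefixSum B rb (a ∷ u) rb v + [ ν ]· (- ([ α ]· Y))
        ≡⟨ cong (λ z → S + [ α ]· z + [ β ]· (R + [ extends rb a ]· prefixSum (B ⊕ exponent a) ra u rb v) + [ ν ]· (- ([ α ]· Y)))
                (prefixSum-∷ʳ A ra u ra b v) ⟩
      S + [ α ]· (P + [ extends ra b ]· X) + [ β ]· (R + [ extends rb a ]· prefixSum (B ⊕ exponent a) ra u rb v) + [ ν ]· (- ([ α ]· Y))
        ≡⟨ cong (λ acc′ → S + [ α ]· (P + [ extends ra b ]· X) + [ β ]· (R + [ extends rb a ]· prefixSum acc′ ra u rb v) + [ ν ]· (- ([ α ]· Y)))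
                (⊕-swapʳ acc (exponent b) (exponent a)) ⟩
      S + [ α ]· (P + [ extends ra b ]· X) + [ β ]· (R + [ extends rb a ]· X) + [ ν ]· (- ([ α ]· Y))
        ≡⟨ crossTerms-regroup α β ν S P R ([ extends ra b ]· X) ([ extends rb a ]· X) Y ⟩
      (S + [ β ]· R + [ α ]· P) + ([ α ]· [ extends ra b ]· X + [ β ]· [ extends rb a ]· X + [ ν ]· (- ([ α ]· Y)))
        ≡⟨ cong (_+_ (S + [ β ]· R + [ α ]· P)) (crossTerms q a b (AllBelow-head below) X Y (prefixSum-doubleNegative acc a b u v)) ⟩
      (S + [ β ]· R + [ α ]· P) + [ α ]· [ extends q b ]· X
        ≡⟨ trans (ℤP.+-assoc (S + [ β ]· R) _ _) (cong (_+_ (S + [ β ]· R)) (sym ([]·-distrib-+ α P _))) ⟩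
      (S + [ β ]· R) + [ α ]· (P + [ extends q b ]· X)
        ≡⟨ cong (λ z → (S + [ β ]· R) + [ α ]· z) (sym (prefixSum-∷ʳ A ra u q b v)) ⟩
      prefixSum acc q (a ∷ u) q (b ∷ v) ∎
      where
      open ≡-Reasoning
      α = extends q a
      β = extends q b
      ν = isNeg a ∧ isNeg b
      ra = runAfter a
      rb = runAfter b
      A = acc ⊕ exponent a
      B = acc ⊕ exponent b
      S = shuffleRest acc (a ∷ u) (b ∷ v)
      R = prefixSumʳ B rb (a ∷ u) v
      P = prefixSum A ra u closed (b ∷ v)
      X = prefixSum (A ⊕ exponent b) ra u rb v
      Y = prefixSum A ra u ra v

    shuffleFill≡prefixSum : ∀ acc q u v → AllBelow u v → shuffleFill acc q u v ≡ prefixSum acc q u q v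
    shuffleFill≡prefixSum acc q []      v       below =
      trans (pairLC-singleton v (λ w → fillSumFrom k lo acc q w φ)) (fillSumFrom≡prefixSumʳ acc q v)
    shuffleFill≡prefixSum acc q (a ∷ u) []      below =
      trans (pairLC-singleton (a ∷ u) (λ w → fillSumFrom k lo acc q w φ)) (fillSumFrom≡prefixSum acc q q (a ∷ u))
    shuffleFill≡prefixSum acc q au@(a ∷ u) bv@(b ∷ v) below = shuffleFill-∷≡prefixSum acc q a u b v below
      (shuffleFill≡prefixSum _ _ u bv (AllBelow-tailˡ below))
      (shuffleFill≡prefixSum _ _ au v (AllBelow-tailʳ below))
      (shuffleFill≡prefixSum _ _ u v (AllBelow-tailˡ (AllBelow-tailʳ below)))

    fillSum-suc-product : ∀ u v → AllBelow u v →
      fillSum (suc k) lo u (λ m → fillSum (suc k) lo v (λ m′ → φ (mulM m m′)))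
        ≡ pairLC (star u v) (λ w → fillSum (suc k) lo w φ)
    fillSum-suc-product u v below =
      trans (prefixSum-product (fin 0) free (fin 0) free u v below) (sym (shuffleFill≡prefixSum (fin 0) free u v below))

  fillSum-product : ∀ k lo u v → AllBelow u v → ∀ φ →
    fillSum k lo u (λ m → fillSum k lo v (λ m′ → φ (mulM m m′))) ≡ pairLC (star u v) (λ w → fillSum k lo w φ)
  fillSum-product zero    lo []      []      below φ =
    trans (cong φ (mulM-identityˡ one)) (sym (pairLC-singleton [] (λ w → fillSum zero lo w φ)))
  fillSum-product zero    lo []      (b ∷ v) below φ = refl
  fillSum-product zero    lo (a ∷ u) []      below φ = refl
  fillSum-product zero    lo (a ∷ u) (b ∷ v) below φ = sym (begin
    pairLC (star (a ∷ u) (b ∷ v)) g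
      ≡⟨ pairLC-star-∷ a u b v g ⟩
    pairLC (star u (b ∷ v)) (λ _ → + 0) + pairLC (star (a ∷ u) v) (λ _ → + 0) + [ ν ]· (- pairLC (star u v) (λ _ → + 0))
      ≡⟨ cong₂ _+_ (cong₂ _+_ (pairLC-zero (star u (b ∷ v))) (pairLC-zero (star (a ∷ u) v)))
                   (trans (cong (λ z → [ ν ]· (- z)) (pairLC-zero (star u v))) ([]·-zero ν)) ⟩
    + 0 ∎)
    where
    open ≡-Reasoning
    g = λ w → fillSum zero lo w φ
    ν = isNeg a ∧ isNeg b
  fillSum-product (suc k) lo u v below φ = Step.fillSum-suc-product k lo φ (λ u v below ψ → fillSum-product k (suc lo) u v below ψ) u v below

descent : ℤ → ℤ → Bool
descent (+ p) (+ n) = n ℕ.<ᵇ p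
descent _     _     = false

data SameShape : List ℤ → List ℤ → Set where
  nil    : SameShape [] []
  single : ∀ {x y} → isNeg x ≡ isNeg y → SameShape (x ∷ []) (y ∷ [])
  cons   : ∀ {x x′ xs y y′ ys} → isNeg x ≡ isNeg y → descent x x′ ≡ descent y y′ →
           SameShape (x′ ∷ xs) (y′ ∷ ys) → SameShape (x ∷ x′ ∷ xs) (y ∷ y′ ∷ ys)

SameShape-head : ∀ {x xs y ys} → SameShape (x ∷ xs) (y ∷ ys) → isNeg x ≡ isNeg y
SameShape-head (single s)   = s
SameShape-head (cons s _ _) = s

mutual
  shape-cong : ∀ {xs ys} → SameShape xs ys → shape xs ≡ shape ys
  shape-cong nil = refl
  shape-cong (single {+ _}      {+ _}      _) = refl
  shape-cong (single { -[1+ _ ]} { -[1+ _ ]} _) = refl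
  shape-cong s@(cons {+ _}      {y = + _}      _ _ _) = shapeAfter-cong s
  shape-cong (cons   { -[1+ _ ]} {y = -[1+ _ ]} _ _ s) = cong ((ε , false) ∷_) (shape-cong s)

  shapeAfter-cong : ∀ {p c xs ys} → SameShape (+ p ∷ xs) (+ c ∷ ys) → shapeAfter p xs ≡ shapeAfter c ys
  shapeAfter-cong (single _) = refl
  shapeAfter-cong (cons {x′ = + _}      {y′ = + _}      _ d s) = cong₂ _∷_ (cong (fin 1 ,_) d) (shapeAfter-cong s)
  shapeAfter-cong (cons {x′ = -[1+ _ ]} {y′ = -[1+ _ ]} _ _ s) = cong ((fin 1 , true) ∷_) (shape-cong s)
  shapeAfter-cong (cons {x′ = + _}      {y′ = -[1+ _ ]} _ _ s) with () ← SameShape-head s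
  shapeAfter-cong (cons {x′ = -[1+ _ ]} {y′ = + _}      _ _ s) with () ← SameShape-head s

isNeg-shift : ∀ m x → isNeg (shift m x) ≡ isNeg x
isNeg-shift m       (+ a)     = refl
isNeg-shift zero    -[1+ j ]  = refl
isNeg-shift (suc m) -[1+ j ]  = refl

descent-shift : ∀ m x x′ → descent (shift m x) (shift m x′) ≡ descent x x′
descent-shift m       (+ a)    (+ b)    = trans (cong₂ ℕ._<ᵇ_ (ℕP.+-comm b m) (ℕP.+-comm a m)) (<ᵇ-+ˡ m)
  where
  <ᵇ-+ˡ : ∀ m → (m ℕ.+ b ℕ.<ᵇ m ℕ.+ a) ≡ (b ℕ.<ᵇ a)
  <ᵇ-+ˡ zero    = refl
  <ᵇ-+ˡ (suc m) = <ᵇ-+ˡ m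
descent-shift zero    (+ a)    -[1+ j ] = refl
descent-shift (suc m) (+ a)    -[1+ j ] = refl
descent-shift zero    -[1+ i ] x′       = refl
descent-shift (suc m) -[1+ i ] x′       = refl

SameShape-shift : ∀ m xs → SameShape (map (shift m) xs) xs
SameShape-shift m []            = nil
SameShape-shift m (x ∷ [])      = single (isNeg-shift m x)
SameShape-shift m (x ∷ x′ ∷ xs) = cons (isNeg-shift m x) (descent-shift m x x′) (SameShape-shift m (x′ ∷ xs))

shape-shift : ∀ m xs → shape (map (shift m) xs) ≡ shape xs
shape-shift m xs = shape-cong (SameShape-shift m xs)

All-drop-mid : ∀ {A : Set} {P : A → Set} ws {x : A} {ys} → All P (ws ++ x ∷ ys) → All P (ws ++ ys)
All-drop-mid ws all = AllP.++⁺ (proj₁ (AllP.++⁻ ws all)) (All.tail (proj₂ (AllP.++⁻ ws all)))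

Unique-drop-mid : ∀ {A : Set} (ws : List A) {x ys} → Unique (ws ++ x ∷ ys) → Unique (ws ++ ys) × x ∉ ws ++ ys
Unique-drop-mid []       (x≢ys ∷ u) = u , AllP.All¬⇒¬Any x≢ys
Unique-drop-mid (w ∷ ws) (w≢ ∷ u) with Unique-drop-mid ws u
... | u′ , x∉ = All-drop-mid ws w≢ ∷ u′ , λ
  { (here x≡w) → All.lookup w≢ (ListMP.∈-++⁺ʳ ws (here refl)) (sym x≡w)
  ; (there x∈) → x∉ x∈ }

All-<-suc : ∀ {n xs} → All (ℕ._< suc n) xs → n ∉ xs → All (ℕ._< n) xs
All-<-suc []         n∉ = []
All-<-suc (lt ∷ lts) n∉ = ℕP.≤∧≢⇒< (ℕP.≤-pred lt) (λ x≡n → n∉ (here (sym x≡n))) ∷ All-<-suc lts (n∉ ∘ there)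

Unique-All-<⇒↭upTo : ∀ n {xs} → Unique xs → All (ℕ._< n) xs → n ℕ.≤ length xs → xs ↭ upTo n
Unique-All-<⇒↭upTo zero    {[]}    _ _          _ = ↭-refl
Unique-All-<⇒↭upTo zero    {_ ∷ _} _ (() ∷ _)   _
Unique-All-<⇒↭upTo (suc n) {xs}    u below     n<len with n ∈? xs
... | no n∉ = contradiction n<len (ℕP.<-irrefl (sym (trans (PermP.↭-length xs↭) (ListP.length-upTo n))))
  where
  xs↭ = Unique-All-<⇒↭upTo n u (All-<-suc below n∉) (ℕP.<⇒≤ n<len)
... | yes n∈ with ListMP.∈-∃++ n∈
...   | ws , ys , refl with Unique-drop-mid ws u
...     | u′ , n∉ = begin
  ws ++ n ∷ ys   ↭⟨ PermP.shift n ws ys ⟩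
  n ∷ ws ++ ys   ↭⟨ Perm.prep n (Unique-All-<⇒↭upTo n u′ (All-<-suc (All-drop-mid ws below) n∉) shorter) ⟩
  n ∷ upTo n     ↭⟨ PermP.∷↭∷ʳ n (upTo n) ⟩
  upTo n ∷ʳ n    ≡⟨ ListP.upTo-∷ʳ n ⟩
  upTo (suc n)   ∎
  where
  open Perm.PermutationReasoning
  shorter : n ℕ.≤ length (ws ++ ys)
  shorter = ℕP.≤-pred (subst (suc n ℕ.≤_) (PermP.↭-length (PermP.shift n ws ys)) n<len)

module Lex = StrictTotalOrder (×-strictTotalOrder ℕP.<-strictTotalOrder ℕP.<-strictTotalOrder)

key : ℕ × ℤ → ℕ × ℕ
key (i , a) = ∣ a ∣ , i

precedes : ℕ × ℤ → ℕ × ℤ → Bool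
precedes (j , b) (i , a) = (∣ b ∣ ℕ.<ᵇ ∣ a ∣) ∨ ((∣ b ∣ ℕ.≡ᵇ ∣ a ∣) ∧ (j ℕ.<ᵇ i))

rank : List (ℕ × ℤ) → ℕ × ℤ → ℕ
rank xs p = foldr (λ q r → if precedes q p then suc r else r) 0 xs

stLetter : List (ℕ × ℤ) → ℕ × ℤ → ℤ
stLetter xs (i , a) = if isNeg a then -[1+ rank xs (i , a) ] else + suc (rank xs (i , a))

indexed : List ℤ → List (ℕ × ℤ)
indexed w = zip (upTo (length w)) w

st≡map-stLetter : ∀ w → st w ≡ map (stLetter (indexed w)) (indexed w)
st≡map-stLetter w = refl

precedes-sound : ∀ q p → precedes q p ≡ true → key q Lex.< key p
precedes-sound (j , b) (i , a) e with ∣ b ∣ ℕ.<ᵇ ∣ a ∣ in b<a | ∣ b ∣ ℕ.≡ᵇ ∣ a ∣ in b≡a | j ℕ.<ᵇ i in j<i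
... | true  | _    | _    = inj₁ (ℕP.<ᵇ⇒< _ _ (≡true⇒T b<a))
... | false | true | true = inj₂ (ℕP.≡ᵇ⇒≡ _ _ (≡true⇒T b≡a) , ℕP.<ᵇ⇒< _ _ (≡true⇒T j<i))

precedes-complete : ∀ q p → key q Lex.< key p → precedes q p ≡ true
precedes-complete (j , b) (i , a) (inj₁ b<a) rewrite T⇒≡true (ℕP.<⇒<ᵇ b<a) = refl
precedes-complete (j , b) (i , a) (inj₂ (b≡a , j<i))
  rewrite T⇒≡true (ℕP.≡⇒≡ᵇ _ _ b≡a) | T⇒≡true (ℕP.<⇒<ᵇ j<i) = ∨-zeroʳ (∣ b ∣ ℕ.<ᵇ ∣ a ∣)

precedes-irrefl : ∀ p → precedes p p ≡ false
precedes-irrefl p with precedes p p in e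
... | false = refl
... | true  = contradiction (precedes-sound p p e) (Lex.irrefl (refl , refl))

rank-mono : ∀ xs q p → key q Lex.< key p → rank xs q ℕ.≤ rank xs p
rank-mono []       q p q<p = ℕ.z≤n
rank-mono (x ∷ xs) q p q<p with precedes x q in x<q | precedes x p in x<p
... | true  | true  = ℕ.s≤s (rank-mono xs q p q<p)
... | false | true  = ℕP.m≤n⇒m≤1+n (rank-mono xs q p q<p)
... | false | false = rank-mono xs q p q<p
... | true  | false = contradiction (trans (sym (precedes-complete x p (Lex.trans (precedes-sound x q x<q) q<p))) x<p) λ ()

rank-strict : ∀ xs q p → q ∈ xs → key q Lex.< key p → rank xs q ℕ.< rank xs p
rank-strict (x ∷ xs) q p (here refl) q<p rewrite precedes-irrefl q | precedes-complete q p q<p = ℕ.s≤s (rank-mono xs q p q<p)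
rank-strict (x ∷ xs) q p (there q∈) q<p with precedes x q in x<q | precedes x p in x<p
... | true  | true  = ℕ.s≤s (rank-strict xs q p q∈ q<p)
... | false | true  = ℕP.m≤n⇒m≤1+n (rank-strict xs q p q∈ q<p)
... | false | false = rank-strict xs q p q∈ q<p
... | true  | false = contradiction (trans (sym (precedes-complete x p (Lex.trans (precedes-sound x q x<q) q<p))) x<p) λ ()

rank-≤-length : ∀ xs p → rank xs p ℕ.≤ length xs
rank-≤-length []       p = ℕ.z≤n
rank-≤-length (x ∷ xs) p with precedes x p
... | true  = ℕ.s≤s (rank-≤-length xs p)
... | false = ℕP.m≤n⇒m≤1+n (rank-≤-length xs p)

rank-<-length : ∀ xs {p} → p ∈ xs → rank xs p ℕ.< length xs
rank-<-length (p ∷ xs) (here refl) rewrite precedes-irrefl p = ℕ.s≤s (rank-≤-length xs p)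
rank-<-length (x ∷ xs) {p} (there p∈) with precedes x p
... | true  = ℕ.s≤s (rank-<-length xs p∈)
... | false = ℕP.m≤n⇒m≤1+n (rank-<-length xs p∈)

rank-injective : ∀ xs {p q} → p ∈ xs → q ∈ xs → proj₁ p ≢ proj₁ q → rank xs p ≢ rank xs q
rank-injective xs {p} {q} p∈ q∈ i≢j r≡ with Lex.compare (key p) (key q)
... | tri< p<q _ _ = ℕP.<-irrefl r≡ (rank-strict xs p q p∈ p<q)
... | tri≈ _ (_ , i≡j) _ = i≢j i≡j
... | tri> _ _ q<p = ℕP.<-irrefl (sym r≡) (rank-strict xs q p q∈ q<p)

module _ {A : Set} where

  map-proj₂-zip-applyUpTo : ∀ (f : ℕ → ℕ) (w : List A) → map proj₂ (zip (applyUpTo f (length w)) w) ≡ w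
  map-proj₂-zip-applyUpTo f []      = refl
  map-proj₂-zip-applyUpTo f (x ∷ w) = cong (x ∷_) (map-proj₂-zip-applyUpTo (f ∘ suc) w)

  map-proj₁-zip-applyUpTo : ∀ (f : ℕ → ℕ) (w : List A) → map proj₁ (zip (applyUpTo f (length w)) w) ≡ applyUpTo f (length w)
  map-proj₁-zip-applyUpTo f []      = refl
  map-proj₁-zip-applyUpTo f (x ∷ w) = cong (f 0 ∷_) (map-proj₁-zip-applyUpTo (f ∘ suc) w)

  Linked-zip-applyUpTo : ∀ (f : ℕ → ℕ) (w : List A) → (∀ i → f i ℕ.< f (suc i)) →
                         Linked (λ p q → proj₁ p ℕ.< proj₁ q) (zip (applyUpTo f (length w)) w)
  Linked-zip-applyUpTo f []          inc = []
  Linked-zip-applyUpTo f (x ∷ [])    inc = [-]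
  Linked-zip-applyUpTo f (x ∷ y ∷ w) inc = inc 0 ∷ Linked-zip-applyUpTo (f ∘ suc) (y ∷ w) (inc ∘ suc)

length-indexed : ∀ w → length (indexed w) ≡ length w
length-indexed w = trans (sym (ListP.length-map proj₂ (indexed w))) (cong length (map-proj₂-zip-applyUpTo (λ i → i) w))

module _ (X : List (ℕ × ℤ)) where

  ranks-unique : ∀ {Y} → Y ⊆ X → AllPairs (λ p q → proj₁ p ≢ proj₁ q) Y → Unique (map (rank X) Y)
  ranks-unique         sub []         = []
  ranks-unique {y ∷ Y} sub (y≢ ∷ Y≢) =
    AllP.map⁺ (All.tabulate (λ q∈ → rank-injective X (sub (here refl)) (sub (there q∈)) (All.lookup y≢ q∈)))
    ∷ ranks-unique (sub ∘ there) Y≢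

  isNeg-stLetter : ∀ p → isNeg (stLetter X p) ≡ isNeg (proj₂ p)
  isNeg-stLetter (i , + _)     = refl
  isNeg-stLetter (i , -[1+ _ ]) = refl

  descent-stLetter : ∀ {p q} → p ∈ X → q ∈ X → proj₁ p ℕ.< proj₁ q →
                     descent (stLetter X p) (stLetter X q) ≡ descent (proj₂ p) (proj₂ q)
  descent-stLetter {i , + α}      {j , + β}      p∈ q∈ i<j = <ᵇ-cong-⇔ β<α rank<
    where
    p = (i , + α)
    q = (j , + β)
    β<α : rank X q ℕ.< rank X p → β ℕ.< α
    β<α rq<rp with ℕP.<-cmp α β
    ... | tri< α<β _ _ = contradiction rq<rp (ℕP.<⇒≯ (rank-strict X p q p∈ (inj₁ α<β)))
    ... | tri≈ _ α≡β _ = contradiction rq<rp (ℕP.<⇒≯ (rank-strict X p q p∈ (inj₂ (α≡β , i<j))))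
    ... | tri> _ _ β<α = β<α
    rank< : β ℕ.< α → rank X q ℕ.< rank X p
    rank< β<α = rank-strict X q p q∈ (inj₁ β<α)
  descent-stLetter {i , + α}      {j , -[1+ _ ]} p∈ q∈ i<j = refl
  descent-stLetter {i , -[1+ _ ]} {j , _}        p∈ q∈ i<j = refl

  SameShape-stLetter : ∀ {Y} → Y ⊆ X → Linked (λ p q → proj₁ p ℕ.< proj₁ q) Y → SameShape (map (stLetter X) Y) (map proj₂ Y)
  SameShape-stLetter         sub []          = nil
  SameShape-stLetter {p ∷ _} sub [-]         = single (isNeg-stLetter p)
  SameShape-stLetter {p ∷ _} sub (i<j ∷ ord) =
    cons (isNeg-stLetter p) (descent-stLetter (sub (here refl)) (sub (there (here refl))) i<j) (SameShape-stLetter (sub ∘ there) ord)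

shape-st : ∀ w → shape (st w) ≡ shape w
shape-st w = begin
  shape (st w)                       ≡⟨ cong shape (st≡map-stLetter w) ⟩
  shape (map (stLetter X) X)         ≡⟨ shape-cong (SameShape-stLetter X (λ p∈ → p∈) (Linked-zip-applyUpTo (λ i → i) w ℕP.n<1+n)) ⟩
  shape (map proj₂ X)                ≡⟨ cong shape (map-proj₂-zip-applyUpTo (λ i → i) w) ⟩
  shape w                            ∎
  where
  open ≡-Reasoning
  X = indexed w

st-isPermutation : ∀ w → map ∣_∣ (st w) ↭ applyUpTo suc (length w)
st-isPermutation w = begin
  map ∣_∣ (st w)                 ≡⟨ cong (map ∣_∣) (st≡map-stLetter w) ⟩
  map ∣_∣ (map (stLetter X) X)   ≡⟨ sym (ListP.map-∘ X) ⟩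
  map (∣_∣ ∘ stLetter X) X       ≡⟨ ListP.map-cong abs-stLetter X ⟩
  map (suc ∘ rank X) X           ≡⟨ ListP.map-∘ X ⟩
  map suc (map (rank X) X)       ↭⟨ PermP.map⁺ suc ranks↭ ⟩
  map suc (upTo L)               ≡⟨ ListP.map-upTo suc L ⟩
  applyUpTo suc L                ∎
  where
  open Perm.PermutationReasoning
  X = indexed w
  L = length w
  abs-stLetter : ∀ p → ∣ stLetter X p ∣ ≡ suc (rank X p)
  abs-stLetter (i , + _)      = refl
  abs-stLetter (i , -[1+ _ ]) = refl
  distinctIndices : AllPairs (λ p q → proj₁ p ≢ proj₁ q) X
  distinctIndices = AllPairsP.map⁻ (subst Unique (sym (map-proj₁-zip-applyUpTo (λ i → i) w)) (UniqueP.upTo⁺ L))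
  ranks↭ : map (rank X) X ↭ upTo L
  ranks↭ = Unique-All-<⇒↭upTo L (ranks-unique X (λ p∈ → p∈) distinctIndices)
    (AllP.map⁺ (All.tabulate (λ {p} p∈ → subst (rank X p ℕ.<_) (length-indexed w) (rank-<-length X p∈))))
    (ℕP.≤-reflexive (sym (trans (ListP.length-map (rank X) X) (length-indexed w))))

-- Counting signed permutations

indicator : ∀ {A : Set} → DecidableEquality A → A → A → ℤ
indicator _≟_ x y = [ does (x ≟ y) ]· + 1

_≟ʷ_ : DecidableEquality (List ℤ)
_≟ʷ_ = ListP.≡-dec ℤ._≟_

_≟ⁿ_ : DecidableEquality (List ℕ)
_≟ⁿ_ = ListP.≡-dec ℕ._≟_

indicator-∷ : ∀ {A : Set} (_≟_ : DecidableEquality A) x xs y ys →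
              indicator (ListP.≡-dec _≟_) (x ∷ xs) (y ∷ ys) ≡ [ does (x ≟ y) ]· indicator (ListP.≡-dec _≟_) xs ys
indicator-∷ _≟_ x xs y ys with does (x ≟ y)
... | true  = refl
... | false = refl

∑-indicator-* : ∀ (E : List (List ℤ)) t (g : List ℤ → ℤ) → ∑ E (λ τ → indicator _≟ʷ_ t τ * g τ) ≡ ∑ E (indicator _≟ʷ_ t) * g t
∑-indicator-* E t g = trans (∑-cong E pointwise) (∑-*ʳ E (indicator _≟ʷ_ t) (g t))
  where
  pointwise : ∀ τ → indicator _≟ʷ_ t τ * g τ ≡ indicator _≟ʷ_ t τ * g t
  pointwise τ with t ≟ʷ τ
  ... | yes refl = refl
  ... | no  _    = refl

∑-signings : ∀ {ks} → All (0 ℕ.<_) ks → ∀ t → ∑ (signings ks) (indicator _≟ʷ_ t) ≡ indicator _≟ⁿ_ (map ∣_∣ t) ks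
∑-signings []                     []      = refl
∑-signings []                     (x ∷ t) = refl
∑-signings {suc k ∷ ks} (_ ∷ pos) []      = trans (∑-concatMap _ (signings ks) (indicator _≟ʷ_ [])) (∑-zero (signings ks))
∑-signings {suc k ∷ ks} (_ ∷ pos) (x ∷ t) = begin
  ∑ (signings (suc k ∷ ks)) (indicator _≟ʷ_ (x ∷ t))
    ≡⟨ ∑-concatMap _ (signings ks) _ ⟩
  ∑ (signings ks) (λ s → [ does (x ℤ.≟ + suc k) ∧ does (t ≟ʷ s) ]· + 1 + ([ does (x ℤ.≟ -[1+ k ]) ∧ does (t ≟ʷ s) ]· + 1 + + 0))
    ≡⟨ ∑-cong (signings ks) (λ s → eitherSign x (does (t ≟ʷ s))) ⟩
  ∑ (signings ks) (λ s → [ ∣ x ∣ ℕ.≡ᵇ suc k ]· indicator _≟ʷ_ t s)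
    ≡⟨ ∑-[]· (signings ks) _ _ ⟩
  [ ∣ x ∣ ℕ.≡ᵇ suc k ]· ∑ (signings ks) (indicator _≟ʷ_ t)
    ≡⟨ cong ([ ∣ x ∣ ℕ.≡ᵇ suc k ]·_) (∑-signings pos t) ⟩
  [ ∣ x ∣ ℕ.≡ᵇ suc k ]· indicator _≟ⁿ_ (map ∣_∣ t) ks
    ≡⟨ sym (indicator-∷ ℕ._≟_ ∣ x ∣ (map ∣_∣ t) (suc k) ks) ⟩
  indicator _≟ⁿ_ (map ∣_∣ (x ∷ t)) (suc k ∷ ks) ∎
  where
  open ≡-Reasoning
  eitherSign : ∀ x d → [ does (x ℤ.≟ + suc k) ∧ d ]· + 1 + ([ does (x ℤ.≟ -[1+ k ]) ∧ d ]· + 1 + + 0) ≡ [ ∣ x ∣ ℕ.≡ᵇ suc k ]· [ d ]· + 1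
  eitherSign (+ j)     d = trans (ℤP.+-identityʳ _) ([]·-∧ (j ℕ.≡ᵇ suc k) d)
  eitherSign -[1+ j ]  d = trans (ℤP.+-identityˡ _) (trans (ℤP.+-identityʳ _) ([]·-∧ (j ℕ.≡ᵇ k) d))

∑-insertAll : ∀ x ws ys q → x ∉ q → x ∉ ws →
              ∑ (insertAll x q) (indicator _≟ⁿ_ (ws ++ x ∷ ys)) ≡ indicator _≟ⁿ_ (ws ++ ys) q
∑-insertAll x []       ys []      x∉q x∉ws
  rewrite dec-true (x ℕ.≟ x) refl = ℤP.+-identityʳ _
∑-insertAll x []       ys (y ∷ q) x∉q x∉ws
  rewrite dec-true (x ℕ.≟ x) refl = begin
  indicator _≟ⁿ_ ys (y ∷ q) + ∑ (map (y ∷_) (insertAll x q)) (indicator _≟ⁿ_ (x ∷ ys))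
    ≡⟨ cong (_+_ (indicator _≟ⁿ_ ys (y ∷ q))) (trans (∑-map (y ∷_) (insertAll x q) (indicator _≟ⁿ_ (x ∷ ys)))
                                               (∑-cong (insertAll x q) (λ r → indicator-∷ ℕ._≟_ x ys y r))) ⟩
  indicator _≟ⁿ_ ys (y ∷ q) + ∑ (insertAll x q) (λ r → [ does (x ℕ.≟ y) ]· indicator _≟ⁿ_ ys r)
    ≡⟨ cong (λ b → indicator _≟ⁿ_ ys (y ∷ q) + ∑ (insertAll x q) (λ r → [ b ]· indicator _≟ⁿ_ ys r)) (dec-false (x ℕ.≟ y) (x∉q ∘ here)) ⟩
  indicator _≟ⁿ_ ys (y ∷ q) + ∑ (insertAll x q) (λ _ → + 0)
    ≡⟨ trans (cong (_+_ (indicator _≟ⁿ_ ys (y ∷ q))) (∑-zero (insertAll x q))) (ℤP.+-identityʳ _) ⟩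
  indicator _≟ⁿ_ ys (y ∷ q) ∎
  where open ≡-Reasoning
∑-insertAll x (w ∷ ws) ys []      x∉q x∉ws
  rewrite dec-false (w ℕ.≟ x) (x∉ws ∘ here ∘ sym) = refl
∑-insertAll x (w ∷ ws) ys (y ∷ q) x∉q x∉ws
  rewrite dec-false (w ℕ.≟ x) (x∉ws ∘ here ∘ sym) = begin
  + 0 + ∑ (map (y ∷_) (insertAll x q)) (indicator _≟ⁿ_ (w ∷ ws ++ x ∷ ys))
    ≡⟨ trans (ℤP.+-identityˡ _) (∑-map (y ∷_) (insertAll x q) _) ⟩
  ∑ (insertAll x q) (λ r → indicator _≟ⁿ_ (w ∷ ws ++ x ∷ ys) (y ∷ r))
    ≡⟨ ∑-cong (insertAll x q) (λ r → indicator-∷ ℕ._≟_ w (ws ++ x ∷ ys) y r) ⟩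
  ∑ (insertAll x q) (λ r → [ does (w ℕ.≟ y) ]· indicator _≟ⁿ_ (ws ++ x ∷ ys) r)
    ≡⟨ ∑-[]· (insertAll x q) (does (w ℕ.≟ y)) _ ⟩
  [ does (w ℕ.≟ y) ]· ∑ (insertAll x q) (indicator _≟ⁿ_ (ws ++ x ∷ ys))
    ≡⟨ cong ([ does (w ℕ.≟ y) ]·_) (∑-insertAll x ws ys q (x∉q ∘ there) (x∉ws ∘ there)) ⟩
  [ does (w ℕ.≟ y) ]· indicator _≟ⁿ_ (ws ++ ys) q
    ≡⟨ sym (indicator-∷ ℕ._≟_ w (ws ++ ys) y q) ⟩
  indicator _≟ⁿ_ (w ∷ ws ++ ys) (y ∷ q) ∎
  where open ≡-Reasoning

insertAll-↭ : ∀ x q → All (_↭ x ∷ q) (insertAll x q)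
insertAll-↭ x []      = ↭-refl ∷ []
insertAll-↭ x (y ∷ q) = ↭-refl ∷ AllP.map⁺ (All.map (λ r↭ → ↭-trans (Perm.prep y r↭) (Perm.swap y x ↭-refl)) (insertAll-↭ x q))

perms-↭ : ∀ l → All (_↭ l) (perms l)
perms-↭ []       = ↭-refl ∷ []
perms-↭ (x ∷ xs) = AllP.concat⁺ (AllP.map⁺ (All.map (λ q↭ → All.map (λ r↭ → ↭-trans r↭ (Perm.prep x q↭)) (insertAll-↭ x _)) (perms-↭ xs)))

∑-perms : ∀ l {p} → Unique l → p ↭ l → ∑ (perms l) (indicator _≟ⁿ_ p) ≡ + 1
∑-perms [] _ p↭ rewrite PermP.↭-empty-inv p↭ = refl
∑-perms (x ∷ xs) {p} (x∉xs ∷ u) p↭ with ListMP.∈-∃++ (PermP.∈-resp-↭ (↭-sym p↭) (here refl))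
... | ws , ys , refl = begin
  ∑ (perms (x ∷ xs)) (indicator _≟ⁿ_ (ws ++ x ∷ ys))
    ≡⟨ ∑-concatMap (insertAll x) (perms xs) _ ⟩
  ∑ (perms xs) (λ q → ∑ (insertAll x q) (indicator _≟ⁿ_ (ws ++ x ∷ ys)))
    ≡⟨ ∑-cong-All (perms-↭ xs) (λ q q↭ → ∑-insertAll x ws ys q (x∉ ∘ PermP.∈-resp-↭ q↭) (x∉ ∘ PermP.∈-resp-↭ ws++ys↭ ∘ ListMP.∈-++⁺ˡ)) ⟩
  ∑ (perms xs) (indicator _≟ⁿ_ (ws ++ ys))
    ≡⟨ ∑-perms xs u ws++ys↭ ⟩
  + 1 ∎
  where
  open ≡-Reasoning
  x∉ : x ∉ xs
  x∉ = AllP.All¬⇒¬Any x∉xs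
  ws++ys↭ : ws ++ ys ↭ xs
  ws++ys↭ = PermP.drop-mid ws [] p↭

∑-perms-length≢ : ∀ l {p} → length p ≢ length l → ∑ (perms l) (indicator _≟ⁿ_ p) ≡ + 0
∑-perms-length≢ l {p} len≢ = trans (∑-cong-All (perms-↭ l) (λ q q↭ → cong ([_]· + 1) (dec-false (p ≟ⁿ q) (len≢ ∘ length≡ q↭))))
                                   (∑-zero (perms l))
  where
  length≡ : ∀ {q} → q ↭ l → p ≡ q → length p ≡ length l
  length≡ q↭ refl = PermP.↭-length q↭

∑-signedPerms : ∀ k t → map ∣_∣ t ↭ applyUpTo suc (length t) → ∑ (signedPerms k) (indicator _≟ʷ_ t) ≡ indicator ℕ._≟_ k (length t)
∑-signedPerms k t t↭ = begin
  ∑ (signedPerms k) (indicator _≟ʷ_ t)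
    ≡⟨ ∑-concatMap signings (perms P) _ ⟩
  ∑ (perms P) (λ q → ∑ (signings q) (indicator _≟ʷ_ t))
    ≡⟨ ∑-cong-All (perms-↭ P) (λ q q↭ → ∑-signings (All.tabulate (positive ∘ PermP.∈-resp-↭ q↭)) t) ⟩
  ∑ (perms P) (indicator _≟ⁿ_ (map ∣_∣ t))
    ≡⟨ count (k ℕ.≟ length t) ⟩
  indicator ℕ._≟_ k (length t) ∎
  where
  open ≡-Reasoning
  P = applyUpTo suc k
  positive : ∀ {z} → z ∈ P → 0 ℕ.< z
  positive z∈ with ListMP.∈-applyUpTo⁻ suc z∈
  ... | _ , _ , refl = ℕ.s≤s ℕ.z≤n
  count : Dec (k ≡ length t) → ∑ (perms P) (indicator _≟ⁿ_ (map ∣_∣ t)) ≡ indicator ℕ._≟_ k (length t)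
  count (yes refl) = trans (∑-perms P (subst Unique (ListP.map-upTo suc k) (UniqueP.map⁺ ℕP.suc-injective (UniqueP.upTo⁺ k))) t↭)
                           (sym (cong ([_]· + 1) (dec-true (k ℕ.≟ k) refl)))
  count (no k≢) = trans (∑-perms-length≢ P {map ∣_∣ t} (λ len≡ → k≢ (sym (trans (sym (ListP.length-map ∣_∣ t)) (trans len≡ (ListP.length-applyUpTo suc k))))))
                        (sym (cong ([_]· + 1) (dec-false (k ℕ.≟ length t) k≢)))

∑-upTo-indicator : ∀ n {L} → L ℕ.< n → ∑ (upTo n) (λ k → indicator ℕ._≟_ k L) ≡ + 1
∑-upTo-indicator (suc n) {L} L<n =
  trans (cong (_+_ (indicator ℕ._≟_ 0 L)) (trans (cong (λ ks → ∑ ks (λ k → indicator ℕ._≟_ k L)) (sym (ListP.map-upTo suc n)))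
                                                  (∑-map suc (upTo n) (λ k → indicator ℕ._≟_ k L))))
        (atZero L L<n)
  where
  atZero : ∀ L → L ℕ.< suc n → indicator ℕ._≟_ 0 L + ∑ (upTo n) (λ k → indicator ℕ._≟_ (suc k) L) ≡ + 1
  atZero zero    _   = cong (_+_ (+ 1)) (∑-zero (upTo n))
  atZero (suc L) L<n = trans (ℤP.+-identityˡ _) (∑-upTo-indicator n (ℕP.≤-pred L<n))

∑-signedPermsUpTo : ∀ K t → length t ℕ.≤ K → map ∣_∣ t ↭ applyUpTo suc (length t) →
                    ∑ (signedPermsUpTo K) (indicator _≟ʷ_ t) ≡ + 1
∑-signedPermsUpTo K t len≤ t↭ =
  trans (∑-concatMap signedPerms (upTo (suc K)) (indicator _≟ʷ_ t))
        (trans (∑-cong (upTo (suc K)) (λ k → ∑-signedPerms k t t↭)) (∑-upTo-indicator (suc K) (ℕ.s≤s len≤)))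

-- The product formula

pairLC-cong-All : ∀ {P : List ℤ → Set} {X : LC} → All (P ∘ proj₂) X → {f g : List ℤ → ℤ} → (∀ w → P w → f w ≡ g w) → pairLC X f ≡ pairLC X g
pairLC-cong-All all e = ∑-cong-All all (λ (c , w) p → cong (c *_) (e w p))

star-length : ∀ u v → All (λ (c , w) → length w ℕ.≤ length u ℕ.+ length v) (star u v)
star-length []      v       = ℕP.≤-refl ∷ []
star-length (a ∷ u) []      = ℕP.≤-reflexive (cong suc (sym (ℕP.+-identityʳ (length u)))) ∷ []
star-length (a ∷ u) (b ∷ v) =
  AllP.++⁺ (AllP.map⁺ (All.map ℕ.s≤s (star-length u (b ∷ v))))
    (AllP.++⁺ (AllP.map⁺ (All.map (λ le → ℕ.s≤s (ℕP.≤-trans le (ℕP.≤-reflexive (sym (ℕP.+-suc (length u) (length v)))))) (star-length (a ∷ u) v)))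
      correction)
  where
  correction : All (λ (c , w) → length w ℕ.≤ length (a ∷ u) ℕ.+ length (b ∷ v))
                   (if isNeg a ∧ isNeg b then map (λ (c , w) → (- c , a ∷ w)) (star u v) else [])
  correction with isNeg a ∧ isNeg b
  ... | true  = AllP.map⁺ (All.map (λ le → ℕ.s≤s (ℕP.≤-trans le (ℕP.+-monoʳ-≤ (length u) (ℕP.n≤1+n (length v))))) (star-length u v))
  ... | false = []

C≡pairLC : ∀ π σ τ → C π σ τ ≡ pairLC (star π (map (shift (length π)) σ)) (λ w → indicator _≟ʷ_ (st w) τ)
C≡pairLC π σ τ = go (star π (map (shift (length π)) σ))
  where
  go : ∀ X → foldr (λ (c , w) r → if does (w ≟ʷ τ) then c + r else r) (+ 0) (map (λ (c , w) → (c , st w)) X)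
             ≡ pairLC X (λ w → indicator _≟ʷ_ (st w) τ)
  go []            = refl
  go ((c , w) ∷ X) with does (st w ≟ʷ τ)
  ... | true  = cong₂ _+_ (sym (ℤP.*-identityʳ c)) (go X)
  ... | false = trans (go X) (sym (trans (cong (_+ pairLC X (λ w → indicator _≟ʷ_ (st w) τ)) (ℤP.*-zeroʳ c)) (ℤP.+-identityˡ _)))

∑-pairLC-comm : ∀ (E : List (List ℤ)) (X : LC) (k : List ℤ → List ℤ → ℤ) (g : List ℤ → ℤ) →
  ∑ E (λ τ → pairLC X (λ w → k w τ) * g τ) ≡ pairLC X (λ w → ∑ E (λ τ → k w τ * g τ))
∑-pairLC-comm E X k g = begin
  ∑ E (λ τ → pairLC X (λ w → k w τ) * g τ)
    ≡⟨ ∑-cong E (λ τ → sym (∑-*ʳ X (λ (c , w) → c * k w τ) (g τ))) ⟩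
  ∑ E (λ τ → ∑ X (λ (c , w) → c * k w τ * g τ))
    ≡⟨ ∑-comm E X (λ τ (c , w) → c * k w τ * g τ) ⟩
  ∑ X (λ (c , w) → ∑ E (λ τ → c * k w τ * g τ))
    ≡⟨ ∑-cong X (λ (c , w) → trans (∑-cong E (λ τ → ℤP.*-assoc c (k w τ) (g τ))) (∑-*ˡ E c _)) ⟩
  pairLC X (λ w → ∑ E (λ τ → k w τ * g τ)) ∎
  where open ≡-Reasoning

length-signedPerm : ∀ {m π} → IsSignedPerm m π → length π ≡ m
length-signedPerm {m} {π} (_ , π↭) = trans (sym (ListP.length-map ∣_∣ π)) (trans (PermP.↭-length π↭) (ListP.length-applyUpTo suc m))

AllBelow-shift : ∀ {m n π σ} → IsSignedPerm m π → IsSignedPerm n σ → AllBelow π (map (shift (length π)) σ)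
AllBelow-shift {m} {n} {π} {σ} π∈ (nonzero , _) = All.tabulate below
  where
  L = length π
  bounded : ∀ {b} → + b ∈ π → b ℕ.≤ L
  bounded b∈ with ListMP.∈-applyUpTo⁻ suc (PermP.∈-resp-↭ (proj₂ π∈) (ListMP.∈-map⁺ ∣_∣ b∈))
  ... | i , i<m , refl = subst (suc i ℕ.≤_) (sym (length-signedPerm π∈)) i<m
  belowShifted : ∀ {b z} → b ℕ.≤ L → z ∈ σ → PosBelow (+ b) (shift L z)
  belowShifted {z = + zero}    b≤L z∈ = contradiction refl (All.lookup nonzero z∈)
  belowShifted {z = + suc a}   b≤L z∈ = ℕ.s≤s (ℕP.≤-trans b≤L (ℕP.m≤n+m L a))
  belowShifted {z = -[1+ j ]}  b≤L z∈ with L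
  ... | zero  = tt
  ... | suc _ = tt
  below : ∀ {x} → x ∈ π → All (PosBelow x) (map (shift L) σ)
  below {+ b}      b∈ = AllP.map⁺ (All.tabulate (belowShifted (bounded b∈)))
  below { -[1+ i ]} _  = All.tabulate (λ _ → tt)

module _ (N : ℕ) where
  open Fillings N
  open QuasiShuffle N

  pairP-F-wcomp : ∀ τ φ → pairP (F N (wcomp τ)) φ ≡ fillSum N 0 τ φ
  pairP-F-wcomp τ φ =
    trans (pairP-F N (wcomp τ) φ) (trans (cong (λ L → ∑ (gen N L 0) φ) (expand-wcomp τ)) (∑-gen-shape N 0 refl τ φ))

  fillSum-shape : ∀ τ τ′ φ → shape τ ≡ shape τ′ → fillSum N 0 τ φ ≡ fillSum N 0 τ′ φ
  fillSum-shape τ τ′ φ same =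
    trans (sym (∑-gen-shape N 0 refl τ φ)) (trans (cong (λ L → ∑ (gen N L 0) φ) same) (∑-gen-shape N 0 refl τ′ φ))

  coeff-*P-wcomp : ∀ μ π σ → AllBelow π (map (shift (length π)) σ) →
    coeff μ (F N (wcomp π) *P F N (wcomp σ)) ≡ pairLC (star π (map (shift (length π)) σ)) (λ w → fillSum N 0 w (δ μ))
  coeff-*P-wcomp μ π σ below = begin
    coeff μ (F N (wcomp π) *P F N (wcomp σ))
      ≡⟨ coeff≡pairP-δ μ (F N (wcomp π) *P F N (wcomp σ)) ⟩
    pairP (F N (wcomp π) *P F N (wcomp σ)) (δ μ)
      ≡⟨ pairP-*P (F N (wcomp π)) (F N (wcomp σ)) (δ μ) ⟩
    pairP (F N (wcomp π)) (λ m → pairP (F N (wcomp σ)) (λ m′ → δ μ (mulM m m′)))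
      ≡⟨ pairP-cong (F N (wcomp π)) (λ m → trans (pairP-F-wcomp σ _) (fillSum-shape σ σ′ _ (sym (shape-shift (length π) σ)))) ⟩
    pairP (F N (wcomp π)) (λ m → fillSum N 0 σ′ (λ m′ → δ μ (mulM m m′)))
      ≡⟨ pairP-F-wcomp π _ ⟩
    fillSum N 0 π (λ m → fillSum N 0 σ′ (λ m′ → δ μ (mulM m m′)))
      ≡⟨ fillSum-product N 0 π σ′ below (δ μ) ⟩
    pairLC (star π σ′) (λ w → fillSum N 0 w (δ μ)) ∎
    where
    open ≡-Reasoning
    σ′ = map (shift (length π)) σ

  ∑-signedPermsUpTo-st : ∀ K w φ → length w ℕ.≤ K →
    ∑ (signedPermsUpTo K) (λ τ → indicator _≟ʷ_ (st w) τ * fillSum N 0 τ φ) ≡ fillSum N 0 w φ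
  ∑-signedPermsUpTo-st K w φ len≤ = begin
    ∑ (signedPermsUpTo K) (λ τ → indicator _≟ʷ_ (st w) τ * fillSum N 0 τ φ)
      ≡⟨ ∑-indicator-* (signedPermsUpTo K) (st w) (λ τ → fillSum N 0 τ φ) ⟩
    ∑ (signedPermsUpTo K) (indicator _≟ʷ_ (st w)) * fillSum N 0 (st w) φ
      ≡⟨ cong (_* fillSum N 0 (st w) φ) (∑-signedPermsUpTo K (st w) (subst (ℕ._≤ K) (sym length-st) len≤) st-perm) ⟩
    + 1 * fillSum N 0 (st w) φ
      ≡⟨ trans (ℤP.*-identityˡ _) (fillSum-shape (st w) w φ (shape-st w)) ⟩
    fillSum N 0 w φ ∎
    where
    open ≡-Reasoning
    length-st : length (st w) ≡ length w
    length-st = trans (ListP.length-map _ (indexed w)) (length-indexed w)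
    st-perm : map ∣_∣ (st w) ↭ applyUpTo suc (length (st w))
    st-perm = subst (λ L → map ∣_∣ (st w) ↭ applyUpTo suc L) (sym length-st) (st-isPermutation w)

  coeff-expansion : ∀ μ π σ E →
    coeff μ (concatMap (λ τ → scaleP (C π σ τ) (F N (wcomp τ))) E)
      ≡ pairLC (star π (map (shift (length π)) σ)) (λ w → ∑ E (λ τ → indicator _≟ʷ_ (st w) τ * fillSum N 0 τ (δ μ)))
  coeff-expansion μ π σ E = begin
    coeff μ (concatMap (λ τ → scaleP (C π σ τ) (F N (wcomp τ))) E)
      ≡⟨ coeff≡pairP-δ μ (concatMap (λ τ → scaleP (C π σ τ) (F N (wcomp τ))) E) ⟩
    pairP (concatMap (λ τ → scaleP (C π σ τ) (F N (wcomp τ))) E) (δ μ)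
      ≡⟨ pairP-concatMap (λ τ → scaleP (C π σ τ) (F N (wcomp τ))) E (δ μ) ⟩
    ∑ E (λ τ → pairP (scaleP (C π σ τ) (F N (wcomp τ))) (δ μ))
      ≡⟨ ∑-cong E (λ τ → trans (pairP-scaleP (C π σ τ) (F N (wcomp τ)) (δ μ)) (cong₂ _*_ (C≡pairLC π σ τ) (pairP-F-wcomp τ (δ μ)))) ⟩
    ∑ E (λ τ → pairLC X (λ w → indicator _≟ʷ_ (st w) τ) * fillSum N 0 τ (δ μ))
      ≡⟨ ∑-pairLC-comm E X (λ w τ → indicator _≟ʷ_ (st w) τ) (λ τ → fillSum N 0 τ (δ μ)) ⟩
    pairLC X (λ w → ∑ E (λ τ → indicator _≟ʷ_ (st w) τ * fillSum N 0 τ (δ μ))) ∎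
    where
    open ≡-Reasoning
    X = star π (map (shift (length π)) σ)

corollary5p7 : (m n : ℕ) (π σ : List ℤ) → IsSignedPerm m π → IsSignedPerm n σ →
               (N : ℕ) (μ : Mono N) →
               coeff μ (F N (wcomp π) *P F N (wcomp σ))
                 ≡ coeff μ (concatMap (λ τ → scaleP (C π σ τ) (F N (wcomp τ))) (signedPermsUpTo (m ℕ.+ n)))
corollary5p7 m n π σ π∈ σ∈ N μ = begin
  coeff μ (F N (wcomp π) *P F N (wcomp σ))
    ≡⟨ coeff-*P-wcomp N μ π σ (AllBelow-shift π∈ σ∈) ⟩
  pairLC X (λ w → fillSum N 0 w (δ μ))
    ≡⟨ pairLC-cong-All (star-length π σ′) (λ w len≤ → sym (∑-signedPermsUpTo-st N (m ℕ.+ n) w (δ μ) (subst (length w ℕ.≤_) lengths len≤))) ⟩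
  pairLC X (λ w → ∑ E (λ τ → indicator _≟ʷ_ (st w) τ * fillSum N 0 τ (δ μ)))
    ≡⟨ sym (coeff-expansion N μ π σ E) ⟩
  coeff μ (concatMap (λ τ → scaleP (C π σ τ) (F N (wcomp τ))) E) ∎
  where
  open ≡-Reasoning
  open Fillings N using (fillSum)
  σ′ = map (shift (length π)) σ
  X = star π σ′
  E = signedPermsUpTo (m ℕ.+ n)
  lengths : length π ℕ.+ length σ′ ≡ m ℕ.+ n
  lengths = cong₂ ℕ._+_ (length-signedPerm π∈) (trans (ListP.length-map _ σ) (length-signedPerm σ∈))
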